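{- Let $\mathcal C$ be a set of frame conditions. The following rules are height-preserving admissible in $\mathsf{N}\mathsf{Q}^{\circ}_{=}.\mathsf{K}(\mathcal{C})$ (for any context $\mathcal G\{\}$, nested sequent $\mathcal G$, formula $\phi$, term $t$): (w) from $\mathcal G\{\emptyset\}$ infer $\mathcal G\{\phi\}$; (tw) from $\mathcal G\{\emptyset\}$ infer $\mathcal G\{t\}$; (ew) from $\mathcal G\{\emptyset\}$ infer $\mathcal G\{[\emptyset]\}$; (nec) from $\mathcal G$ infer $[\mathcal G]$. That is, whenever the premise has a proof of height $h$, the conclusion has a proof of height at most $h$.
   Context: In (ew), $[\emptyset]$ is a new empty child component; in (nec), $[\mathcal G]$ is the nested sequent with empty root whose only child is $\mathcal G$. The height of a proof is the length of a maximal branch. Syntax. Terms are variables or constants. Formulas (negation normal form): $\phi ::= P(\vec t)\mid \neg P(\vec t)\mid t=s\mid t\neq s\mid \phi\lor\phi\mid\phi\land\phi\mid\exists x\phi\mid\forall x\phi\mid\Diamond\phi\mid\Box\phi$ ($P$ an $n$-ary predicate, $n\ge 0$). A literal is $P(\vec t)$, $\neg P(\vec t)$, $t=s$ or $t\neq s$; a negative literal is $\neg P(\vec t)$ or $t\neq s$. The negation $\overline{\phi}$ swaps $P(\vec t)/\neg P(\vec t)$, $=/\neq$, $\lor/\land$, $\exists/\forall$, $\Diamond/\Box$ (De Morgan duals). $\phi(t/x)$ is capture-avoiding substitution for free occurrences; formulas differing only in bound variable names are identified. Frames. A frame is $\langle W,R,U,D\rangle$ with $W\neq\emptyset$, $R\subseteq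 W\times W$, $U\neq\emptyset$ and $D_w\subseteq U$ for each $w\in W$. Frame conditions: $\mathbf D$: every $w$ has some $u$ with $wRu$; $\mathbf G(n,k)$ ($n,k\in\mathbb N$): $wR^nu$ and $wR^kv$ imply $uRv$ ($R^0$ = identity); $\mathbf{ID}$: $wRv\Rightarrow D_w\subseteq D_v$; $\mathbf{DD}$: $wRv\Rightarrow D_v\subseteq D_w$; $\mathbf{CD}$: $D_w=U$ for all $w$; $\mathbf{NE}$: $D_w\neq\emptyset$ for all $w$. $\mathcal C$ is a set of such conditions, assumed closed: if one of these conditions holds on every frame satisfying all of $\mathcal C$, it belongs to $\mathcal C$. $\mathbf G$ denotes the set of all $\mathbf G(n,k)\in\mathcal C$. Grammars. Characters $\mathsf f$, $\mathsf b$. A $\Sigma$-system $S$ is a set of productions $c\to s$, $c\in\{\mathsf f,\mathsf b\}$, $s$ a string over $\{\mathsf f,\mathsf b\}$; $s'cr'\to s'sr'$ is a one-step derivation, $\to^*_S$ its reflexive-transitive closure, $L_S(s)=\{t: s\to^*_S t\}$. $S(\mathbf G)$ contains $\mathsf f\to\mathsf b^n\mathsf f^k$ and $\mathsf b\to\mathsf b^k\mathsf f^n$ for each $\mathbf G(n,k)\in\mathbf G$; $S4=\{\mathsf f\to\varepsilon,\mathsf b\to\varepsilon,\mathsf f\to\mathsf f\mathsf f,\mathsf b\to\mathsf b\mathsf b\}$; $S5=\{\mathsf f\to\varepsilon,\mathsf b\to\varepsilon,\mathsf f\to\mathsf b\mathsf f,\mathsf b\to\mathsf b\mathsf f\}$.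 Nested sequents. A flat sequent is $\vec t,\vec\phi$: a finite multiset $\vec t$ of terms (signature) and a finite multiset $\vec\phi$ of formulas. A nested sequent is $\Gamma,[\mathcal H_1],\dots,[\mathcal H_n]$ ($n\ge 0$) with $\Gamma$ flat and $\mathcal H_i$ nested sequents; it is a tree of flat sequents (components), each with a unique name, $\Gamma$ being the root and the roots of the $\mathcal H_i$ its children. A context $\mathcal G\{\}$ has a hole in a component; $\mathcal G\{\mathcal H\}$ fills it, $\mathcal G\{\emptyset\}$ removes it; $\mathcal G\{\cdot\}_{w}\{\cdot\}_{u}$ indicates holes in the components named $w,u$. Propagation: for each parent $w$ and child $u$ we have $w\xrightarrow{\mathsf f}u$ and $u\xrightarrow{\mathsf b}w$; $w\xrightarrow{c_1\cdots c_m}u$ means there are components $w=v_0,\dots,v_m=u$ with $v_{i-1}\xrightarrow{c_i}v_i$ ($w=u$ for the empty string); $w\xrightarrow{L}u$ means $w\xrightarrow{s}u$ for some $s\in L$. Calculus. Rules (premises $\Rightarrow$ conclusion): (ax) $\Rightarrow\mathcal G\{L,\overline L\}$, $L$ a literal; ($\lor$) $\mathcal G\{\phi,\psi\}\Rightarrow\mathcal G\{\phi\lor\psi\}$; ($\land$) $\mathcal G\{\phi\}$, $\mathcal G\{\psi\}\Rightarrow\mathcal G\{\phi\land\psi\}$; ($\exists$) $\mathcal G\{t,\exists x\psi,\psi(t/x)\}\Rightarrow\mathcal G\{t,\exists x\psi\}$; ($\forall$) $\mathcal G\{y,\phi(y/x)\}\Rightarrow\mathcal G\{\forall x\phi\}$,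 $y$ a variable not free in the conclusion; ($\Diamond$) $\mathcal G\{\Diamond\phi\}_w\{\phi\}_u\Rightarrow\mathcal G\{\Diamond\phi\}_w\{\emptyset\}_u$ provided $w\xrightarrow{L}u$, $L=L_{S(\mathbf G)}(\mathsf f)$; ($\Box$) $\mathcal G\{[\phi]\}\Rightarrow\mathcal G\{\Box\phi\}$; (ref) $\mathcal G\{t\neq t\}\Rightarrow\mathcal G\{\emptyset\}$; (rep) $\mathcal G\{t\neq s,N(t/z),N(s/z)\}\Rightarrow\mathcal G\{t\neq s,N(t/z)\}$, $N$ a negative literal; (drep) $\mathcal G\{s,t,t\neq s\}\Rightarrow\mathcal G\{t,t\neq s\}$; (rig) $\mathcal G\{s\neq t\}_w\{s\neq t\}_u\Rightarrow\mathcal G\{s\neq t\}_w\{\emptyset\}_u$, $w\neq u$; (dp) $\mathcal G\{t\}_w\{t\}_u\Rightarrow\mathcal G\{t\}_w\{\emptyset\}_u$, $w\neq u$, $w\xrightarrow{L}u$ with $L=L_{S4\cup S(\mathbf G)}(\mathsf f)$ if $\mathbf{ID}\in\mathcal C,\mathbf{DD}\notin\mathcal C$, $L=L_{S4\cup S(\mathbf G)}(\mathsf b)$ if $\mathbf{DD}\in\mathcal C,\mathbf{ID}\notin\mathcal C$, $L=L_{S5}(\mathsf f)$ if both; (d) $\mathcal G\{[\emptyset]\}\Rightarrow\mathcal G\{\emptyset\}$; (nd) $\mathcal G\{y\}\Rightarrow\mathcal G\{\emptyset\}$, $y$ a variable not free in the conclusion; (cd) $\mathcal G\{t\}\Rightarrow\mathcal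 G\{\emptyset\}$. $\mathsf N\mathsf Q^\circ_=.\mathsf K(\mathcal C)$ consists of ax, $\lor$, $\land$, $\exists$, $\forall$, $\Diamond$, $\Box$, ref, rep, drep, rig, plus dp iff $\mathcal C\cap\{\mathbf{ID},\mathbf{DD}\}\neq\emptyset$, nd iff $\mathbf{NE}\in\mathcal C$, cd iff $\mathbf{CD}\in\mathcal C$, d iff $\mathbf D\in\mathcal C$. A proof is a finite tree of nested sequents whose nodes are conclusions of rule instances with their children as premises and whose leaves are ax instances. -}

module Defs where

open import Data.Nat using (ℕ; zero; suc; _≤_; _⊔_)
open import Data.Fin using (Fin; zero; suc)
open import Data.List using (List; []; _∷_; _++_; [_]; replicate)
open import Data.List.Relation.Unary.Any using (Any)
open import Data.List.Relation.Binary.Permutation.Propositional using (_↭_)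
import Data.List.Relation.Binary.Permutation.Homogeneous as Perm
open import Data.Product using (Σ; ∃; _×_; _,_)
open import Data.Sum using (_⊎_)
open import Data.Empty using (⊥)
open import Relation.Nullary using (¬_)
open import Relation.Binary.PropositionalEquality using (_≡_; _≢_)
open import Relation.Binary.Construct.Closure.ReflexiveTransitive using (Star)

record Frame : Set₁ where
  field
    W   : Set
    R   : W → W → Set
    U   : Set
    Dom : W → U → Set      -- D_w ⊆ U, as a predicate on U
    w₀  : W                -- W ≠ ∅
    u₀  : U                -- U ≠ ∅

data Cond : Set where
  D  : Cond
  Gc : ℕ → ℕ → Cond
  ID DD CD NE : Cond

module _ (F : Frame) where
  open Frame F

  Rpow : ℕ → W → W → Set
  Rpow zero    w v = w ≡ v
  Rpow (suc n) w v = Σ W λ m → R w m × Rpow n m v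

  Holds : Cond → Set
  Holds D       = ∀ w → Σ W λ u → R w u
  Holds (Gc n k) = ∀ w u v → Rpow n w u → Rpow k w v → R u v
  Holds ID      = ∀ w v → R w v → ∀ a → Dom w a → Dom v a
  Holds DD      = ∀ w v → R w v → ∀ a → Dom v a → Dom w a
  Holds CD      = ∀ w a → Dom w a
  Holds NE      = ∀ w → Σ U λ a → Dom w a

CondSet : Set₁
CondSet = Cond → Set

Closed : CondSet → Set₁
Closed 𝒞 = ∀ c → (∀ (F : Frame) → (∀ c′ → 𝒞 c′ → Holds F c′) → Holds F c) → 𝒞 c

data Chr : Set where
  𝖿 𝖻 : Chr

-- a Σ-system: a (possibly infinite) set of productions c → s
Grammar : Set₁
Grammar = Chr → List Chr → Set

_∪G_ : Grammar → Grammar → Grammar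
(S ∪G T) c s = S c s ⊎ T c s

data Step1 (S : Grammar) : List Chr → List Chr → Set where
  step : ∀ {c s} l r → S c s → Step1 S (l ++ c ∷ r) (l ++ s ++ r)

Lang : Grammar → List Chr → List Chr → Set
Lang S s t = Star (Step1 S) s t

data SG (𝒞 : CondSet) : Grammar where
  fprod : ∀ {n k} → 𝒞 (Gc n k) → SG 𝒞 𝖿 (replicate n 𝖻 ++ replicate k 𝖿)
  bprod : ∀ {n k} → 𝒞 (Gc n k) → SG 𝒞 𝖻 (replicate k 𝖻 ++ replicate n 𝖿)

data S4 : Grammar where
  f-ε  : S4 𝖿 []
  b-ε  : S4 𝖻 []
  f-ff : S4 𝖿 (𝖿 ∷ 𝖿 ∷ [])
  b-bb : S4 𝖻 (𝖻 ∷ 𝖻 ∷ [])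

data S5 : Grammar where
  f-ε  : S5 𝖿 []
  b-ε  : S5 𝖻 []
  f-bf : S5 𝖿 (𝖻 ∷ 𝖿 ∷ [])
  b-bf : S5 𝖻 (𝖻 ∷ 𝖿 ∷ [])

-- Terms and formulas (locally nameless: free variables/constants are
-- named, bound variables are de Bruijn levels, so α-equivalent formulas
-- are syntactically equal)

data Term : Set where
  var : ℕ → Term
  con : ℕ → Term

-- terms inside a formula under n binders
data FTerm (n : ℕ) : Set where
  fr : Term → FTerm n
  bv : Fin n → FTerm n      -- bound variable, level (0 = outermost)

data Fml (n : ℕ) : Set where
  pos  : ℕ → List (FTerm n) → Fml n
  neg  : ℕ → List (FTerm n) → Fml n
  eq   : FTerm n → FTerm n → Fml n
  neq  : FTerm n → FTerm n → Fml n
  _∨_  : Fml n → Fml n → Fml n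
  _∧_  : Fml n → Fml n → Fml n
  ex   : Fml (suc n) → Fml n
  all  : Fml (suc n) → Fml n
  dia  : Fml n → Fml n
  box  : Fml n → Fml n

Formula : Set
Formula = Fml 0

-- negation (De Morgan dual)
dual : ∀ {n} → Fml n → Fml n
dual (pos P ts) = neg P ts
dual (neg P ts) = pos P ts
dual (eq t s)   = neq t s
dual (neq t s)  = eq t s
dual (φ ∨ ψ)    = dual φ ∧ dual ψ
dual (φ ∧ ψ)    = dual φ ∨ dual ψ
dual (ex φ)     = all (dual φ)
dual (all φ)    = ex (dual φ)
dual (dia φ)    = box (dual φ)
dual (box φ)    = dia (dual φ)

data Literal : Formula → Set where
  lpos : ∀ P ts → Literal (pos P ts)
  lneg : ∀ P ts → Literal (neg P ts)
  leq  : ∀ t s → Literal (eq t s)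
  lneq : ∀ t s → Literal (neq t s)

data NegLiteral : Formula → Set where
  nneg : ∀ P ts → NegLiteral (neg P ts)
  nneq : ∀ t s → NegLiteral (neq t s)

-- φ(t/x) for the outermost bound variable: opening with a term
openT : ∀ {n} → Term → FTerm (suc n) → FTerm n
openT t (fr u)       = fr u
openT t (bv zero)    = fr t
openT t (bv (suc i)) = bv i

openTs : ∀ {n} → Term → List (FTerm (suc n)) → List (FTerm n)
openTs t []       = []
openTs t (u ∷ us) = openT t u ∷ openTs t us

inst : ∀ {n} → Fml (suc n) → Term → Fml n
inst (pos P ts) t = pos P (openTs t ts)
inst (neg P ts) t = neg P (openTs t ts)
inst (eq u s)   t = eq (openT t u) (openT t s)
inst (neq u s)  t = neq (openT t u) (openT t s)
inst (φ ∨ ψ)    t = inst φ t ∨ inst ψ t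
inst (φ ∧ ψ)    t = inst φ t ∧ inst ψ t
inst (ex φ)     t = ex (inst φ t)
inst (all φ)    t = all (inst φ t)
inst (dia φ)    t = dia (inst φ t)
inst (box φ)    t = box (inst φ t)

substTm : ℕ → Term → Term → Term
substTm z t (var x) with x Data.Nat.≟ z
... | Relation.Nullary.yes _ = t
... | Relation.Nullary.no  _ = var x
substTm z t (con c) = con c

substFT : ∀ {n} → ℕ → Term → FTerm n → FTerm n
substFT z t (fr u) = fr (substTm z t u)
substFT z t (bv i) = bv i

substFTs : ∀ {n} → ℕ → Term → List (FTerm n) → List (FTerm n)
substFTs z t []       = []
substFTs z t (u ∷ us) = substFT z t u ∷ substFTs z t us

subst : ∀ {n} → Fml n → Term → ℕ → Fml n
subst (pos P ts) t z = pos P (substFTs z t ts)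
subst (neg P ts) t z = neg P (substFTs z t ts)
subst (eq u s)   t z = eq (substFT z t u) (substFT z t s)
subst (neq u s)  t z = neq (substFT z t u) (substFT z t s)
subst (φ ∨ ψ)    t z = subst φ t z ∨ subst ψ t z
subst (φ ∧ ψ)    t z = subst φ t z ∧ subst ψ t z
subst (ex φ)     t z = ex (subst φ t z)
subst (all φ)    t z = all (subst φ t z)
subst (dia φ)    t z = dia (subst φ t z)
subst (box φ)    t z = box (subst φ t z)

FreeFT : ∀ {n} → ℕ → FTerm n → Set
FreeFT y (fr u) = u ≡ var y
FreeFT y (bv i) = ⊥

FreeF : ∀ {n} → ℕ → Fml n → Set
FreeF y (pos P ts) = Any (FreeFT y) ts
FreeF y (neg P ts) = Any (FreeFT y) ts
FreeF y (eq u s)   = FreeFT y u ⊎ FreeFT y s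
FreeF y (neq u s)  = FreeFT y u ⊎ FreeFT y s
FreeF y (φ ∨ ψ)    = FreeF y φ ⊎ FreeF y ψ
FreeF y (φ ∧ ψ)    = FreeF y φ ⊎ FreeF y ψ
FreeF y (ex φ)     = FreeF y φ
FreeF y (all φ)    = FreeF y φ
FreeF y (dia φ)    = FreeF y φ
FreeF y (box φ)    = FreeF y φ

-- Nested sequents: a component is (signature, formulas, children)

data NSeq : Set where
  ⟨_∣_∣_⟩ : List Term → List Formula → List NSeq → NSeq

-- equality of nested sequents as trees of multisets
data _≈_ : NSeq → NSeq → Set where
  node : ∀ {ts ts′ φs φs′ cs cs′} →
         ts ↭ ts′ → φs ↭ φs′ → Perm.Permutation _≈_ cs cs′ →
         ⟨ ts ∣ φs ∣ cs ⟩ ≈ ⟨ ts′ ∣ φs′ ∣ cs′ ⟩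

mutual
  FreeS : ℕ → NSeq → Set
  FreeS y ⟨ ts ∣ φs ∣ cs ⟩ = Any (_≡ var y) ts ⊎ Any (FreeF y) φs ⊎ FreeSL y cs

  FreeSL : ℕ → List NSeq → Set
  FreeSL y []       = ⊥
  FreeSL y (c ∷ cs) = FreeS y c ⊎ FreeSL y cs

-- components are named by paths (lists of child indices) from the root
Path : Set
Path = List ℕ

mutual
  data Valid : Path → NSeq → Set where
    here  : ∀ {S} → Valid [] S
    there : ∀ {i p ts φs cs} → ValidL i p cs → Valid (i ∷ p) ⟨ ts ∣ φs ∣ cs ⟩

  data ValidL : ℕ → Path → List NSeq → Set where
    vz : ∀ {p c cs} → Valid p c → ValidL zero p (c ∷ cs)
    vs : ∀ {i p c cs} → ValidL i p cs → ValidL (suc i) p (c ∷ cs)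

mutual
  modify : Path → (NSeq → NSeq) → NSeq → NSeq
  modify []      f S = f S
  modify (i ∷ p) f ⟨ ts ∣ φs ∣ cs ⟩ = ⟨ ts ∣ φs ∣ modifyL i p f cs ⟩

  modifyL : ℕ → Path → (NSeq → NSeq) → List NSeq → List NSeq
  modifyL i       p f []       = []
  modifyL zero    p f (c ∷ cs) = modify p f c ∷ cs
  modifyL (suc i) p f (c ∷ cs) = c ∷ modifyL i p f cs

add : List Term → List Formula → List NSeq → NSeq → NSeq
add ts φs cs ⟨ ts′ ∣ φs′ ∣ cs′ ⟩ = ⟨ ts′ ++ ts ∣ φs′ ++ φs ∣ cs′ ++ cs ⟩

-- G{ts, φs, cs} where the context is (G, p): hole in component p of G
plug : NSeq → Path → List Term → List Formula → List NSeq → NSeq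
plug G p ts φs cs = modify p (add ts φs cs) G

plugF : NSeq → Path → List Formula → NSeq
plugF G p φs = plug G p [] φs []

emptyS : NSeq
emptyS = ⟨ [] ∣ [] ∣ [] ⟩

data Edge (S : NSeq) : Chr → Path → Path → Set where
  fwd : ∀ {w} i → Valid (w ++ [ i ]) S → Edge S 𝖿 w (w ++ [ i ])
  bwd : ∀ {w} i → Valid (w ++ [ i ]) S → Edge S 𝖻 (w ++ [ i ]) w

data Walk (S : NSeq) : List Chr → Path → Path → Set where
  nil  : ∀ {w} → Walk S [] w w
  cons : ∀ {c s w v u} → Edge S c w v → Walk S s v u → Walk S (c ∷ s) w u

Reach : NSeq → (List Chr → Set) → Path → Path → Set
Reach S L w u = Σ (List Chr) λ s → L s × Walk S s w u

-- The calculus NQ°₌.K(𝒞); Prf 𝒞 S h : a proof of S of height h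
-- (a leaf has height 0, each rule adds 1 to the max of its premises)

module Calculus (𝒞 : CondSet) where

  Ldia : List Chr → Set
  Ldia = Lang (SG 𝒞) [ 𝖿 ]

  data Prf : NSeq → ℕ → Set where
    ax   : ∀ {S G p L} → Valid p G → Literal L →
           S ≈ plugF G p (L ∷ dual L ∷ []) → Prf S 0
    or   : ∀ {S G p φ ψ h} → Valid p G →
           Prf (plugF G p (φ ∷ ψ ∷ [])) h →
           S ≈ plugF G p [ φ ∨ ψ ] → Prf S (suc h)
    and  : ∀ {S G p φ ψ h₁ h₂} → Valid p G →
           Prf (plugF G p [ φ ]) h₁ → Prf (plugF G p [ ψ ]) h₂ →
           S ≈ plugF G p [ φ ∧ ψ ] → Prf S (suc (h₁ ⊔ h₂))
    exR  : ∀ {S G p t ψ h} → Valid p G →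
           Prf (plug G p [ t ] (ex ψ ∷ inst ψ t ∷ []) []) h →
           S ≈ plug G p [ t ] [ ex ψ ] [] → Prf S (suc h)
    allR : ∀ {S G p φ y h} → Valid p G →
           ¬ FreeS y (plugF G p [ all φ ]) →
           Prf (plug G p [ var y ] [ inst φ (var y) ] []) h →
           S ≈ plugF G p [ all φ ] → Prf S (suc h)
    diaR : ∀ {S G w u φ h} → Valid w G → Valid u G →
           Reach G Ldia w u →
           Prf (plugF (plugF G u [ φ ]) w [ dia φ ]) h →
           S ≈ plugF G w [ dia φ ] → Prf S (suc h)
    boxR : ∀ {S G p φ h} → Valid p G →
           Prf (plug G p [] [] [ ⟨ [] ∣ [ φ ] ∣ [] ⟩ ]) h →
           S ≈ plugF G p [ box φ ] → Prf S (suc h)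
    ref  : ∀ {S G p t h} → Valid p G →
           Prf (plugF G p [ neq (fr t) (fr t) ]) h →
           S ≈ G → Prf S (suc h)
    rep  : ∀ {S G p t s N z h} → Valid p G → NegLiteral N →
           Prf (plugF G p (neq (fr t) (fr s) ∷ subst N t z ∷ subst N s z ∷ [])) h →
           S ≈ plugF G p (neq (fr t) (fr s) ∷ subst N t z ∷ []) → Prf S (suc h)
    drep : ∀ {S G p t s h} → Valid p G →
           Prf (plug G p (s ∷ t ∷ []) [ neq (fr t) (fr s) ] []) h →
           S ≈ plug G p [ t ] [ neq (fr t) (fr s) ] [] → Prf S (suc h)
    rig  : ∀ {S G w u s t h} → Valid w G → Valid u G → w ≢ u →
           Prf (plugF (plugF G u [ neq (fr s) (fr t) ]) w [ neq (fr s) (fr t) ]) h →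
           S ≈ plugF G w [ neq (fr s) (fr t) ] → Prf S (suc h)
    -- (dp), in its three variants according to ID/DD ∈ 𝒞
    dpID : ∀ {S G w u t h} → 𝒞 ID → ¬ 𝒞 DD →
           Valid w G → Valid u G → w ≢ u →
           Reach G (Lang (S4 ∪G SG 𝒞) [ 𝖿 ]) w u →
           Prf (plug (plug G u [ t ] [] []) w [ t ] [] []) h →
           S ≈ plug G w [ t ] [] [] → Prf S (suc h)
    dpDD : ∀ {S G w u t h} → 𝒞 DD → ¬ 𝒞 ID →
           Valid w G → Valid u G → w ≢ u →
           Reach G (Lang (S4 ∪G SG 𝒞) [ 𝖻 ]) w u →
           Prf (plug (plug G u [ t ] [] []) w [ t ] [] []) h →
           S ≈ plug G w [ t ] [] [] → Prf S (suc h)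
    dpIDDD : ∀ {S G w u t h} → 𝒞 ID → 𝒞 DD →
           Valid w G → Valid u G → w ≢ u →
           Reach G (Lang S5 [ 𝖿 ]) w u →
           Prf (plug (plug G u [ t ] [] []) w [ t ] [] []) h →
           S ≈ plug G w [ t ] [] [] → Prf S (suc h)
    d    : ∀ {S G p h} → 𝒞 D → Valid p G →
           Prf (plug G p [] [] [ emptyS ]) h →
           S ≈ G → Prf S (suc h)
    nd   : ∀ {S G p y h} → 𝒞 NE → Valid p G → ¬ FreeS y G →
           Prf (plug G p [ var y ] [] []) h →
           S ≈ G → Prf S (suc h)
    cd   : ∀ {S G p t h} → 𝒞 CD → Valid p G →
           Prf (plug G p [ t ] [] []) h →
           S ≈ G → Prf S (suc h)

  HPAdm : NSeq → NSeq → Set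
  HPAdm P C = ∀ h → Prf P h → Σ ℕ λ h′ → h′ ≤ h × Prf C h′

-- Weakening (w), (tw) and (ew) are instances of one fact: a proof of S yields a proof of the same
-- height of every extension T of S, in which components may carry more terms and formulas and more
-- children. By induction on the proof, the extension is pushed up into the premises of each rule,
-- since side conditions (validity of components, propagation paths, w ≠ u) survive extension. The
-- only obstruction is an eigenvariable of (∀) or (nd) that may occur in the added material; it is
-- first swapped with a fresh variable, which preserves height because renaming by an injective map
-- commutes with every rule. Necessitation moves every rule instance one level down in the tree.

module Submission where

open import Defs
open import Data.Product using (_×_; Σ; _,_)
open import Data.List using (List; []; _∷_; _++_; [_]; map)
import Data.List.Properties as List
open import Data.Fin using (zero; suc)
open import Data.Nat using (ℕ; zero; suc; _≤_; _<_; _⊔_; s≤s; _≟_)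
open import Data.Nat.Properties using (≤-trans; ≤-refl; m≤m⊔n; m≤n⊔m; <-irrefl)
open import Data.Sum using (inj₁; inj₂)
open import Data.Empty using (⊥-elim)
open import Function.Base using (_∘_)
open import Function.Definitions using (Injective)
open import Relation.Nullary using (¬_; yes; no)
open import Relation.Binary.PropositionalEquality as Eq
  using (_≡_; refl; sym; trans; cong; cong₂; _≢_; module ≡-Reasoning)
open import Data.List.Relation.Binary.Permutation.Propositional using (_↭_; ↭-refl; ↭-sym; ↭-trans)
import Data.List.Relation.Binary.Permutation.Propositional.Properties as ↭
import Data.List.Relation.Binary.Permutation.Homogeneous as Perm
open import Data.List.Relation.Binary.Pointwise using (Pointwise; []; _∷_; ++⁺)
open import Data.List.Relation.Unary.Any as Any using (Any; here; there)
import Data.List.Relation.Unary.Any.Properties as AnyP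

_↭≈_ : List NSeq → List NSeq → Set
_↭≈_ = Perm.Permutation _≈_

mutual
  ≈-refl : ∀ {S} → S ≈ S
  ≈-refl {⟨ ts ∣ φs ∣ cs ⟩} = node ↭-refl ↭-refl (Perm.refl ≈*-refl)

  ≈*-refl : ∀ {cs} → Pointwise _≈_ cs cs
  ≈*-refl {[]}     = []
  ≈*-refl {c ∷ cs} = ≈-refl ∷ ≈*-refl

mutual
  ≈-sym : ∀ {S T} → S ≈ T → T ≈ S
  ≈-sym (node ts↭ φs↭ cs↭) = node (↭-sym ts↭) (↭-sym φs↭) (↭≈-sym cs↭)

  ↭≈-sym : ∀ {cs ds} → cs ↭≈ ds → ds ↭≈ cs
  ↭≈-sym (Perm.refl pw)      = Perm.refl (≈*-sym pw)
  ↭≈-sym (Perm.prep e P)     = Perm.prep (≈-sym e) (↭≈-sym P)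
  ↭≈-sym (Perm.swap e₁ e₂ P) = Perm.swap (≈-sym e₂) (≈-sym e₁) (↭≈-sym P)
  ↭≈-sym (Perm.trans P Q)    = Perm.trans (↭≈-sym Q) (↭≈-sym P)

  ≈*-sym : ∀ {cs ds} → Pointwise _≈_ cs ds → Pointwise _≈_ ds cs
  ≈*-sym []       = []
  ≈*-sym (e ∷ pw) = ≈-sym e ∷ ≈*-sym pw

≈-trans : ∀ {S T U} → S ≈ T → T ≈ U → S ≈ U
≈-trans (node a b P) (node c d Q) = node (↭-trans a c) (↭-trans b d) (Perm.trans P Q)

≈-reflexive : ∀ {S T} → S ≡ T → S ≈ T
≈-reflexive refl = ≈-refl

↭⇒↭≈ : ∀ {cs ds} → cs ↭ ds → cs ↭≈ ds
↭⇒↭≈ _↭_.refl          = Perm.refl ≈*-refl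
↭⇒↭≈ (_↭_.prep _ P)    = Perm.prep ≈-refl (↭⇒↭≈ P)
↭⇒↭≈ (_↭_.swap _ _ P)  = Perm.swap ≈-refl ≈-refl (↭⇒↭≈ P)
↭⇒↭≈ (_↭_.trans P Q)   = Perm.trans (↭⇒↭≈ P) (↭⇒↭≈ Q)

↭≈-++ʳ : ∀ {cs ds} es → cs ↭≈ ds → (cs ++ es) ↭≈ (ds ++ es)
↭≈-++ʳ es (Perm.refl pw)      = Perm.refl (++⁺ pw ≈*-refl)
↭≈-++ʳ es (Perm.prep e P)     = Perm.prep e (↭≈-++ʳ es P)
↭≈-++ʳ es (Perm.swap e₁ e₂ P) = Perm.swap e₁ e₂ (↭≈-++ʳ es P)
↭≈-++ʳ es (Perm.trans P Q)    = Perm.trans (↭≈-++ʳ es P) (↭≈-++ʳ es Q)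

↭-swap-tails : ∀ {A : Set} (a b c : List A) → (a ++ b) ++ c ↭ (a ++ c) ++ b
↭-swap-tails a b c = ↭-trans (↭.++-assoc a b c)
  (↭-trans (↭.++⁺ˡ a (↭.++-comm b c)) (↭-sym (↭.++-assoc a c b)))

module _ {𝒞 : CondSet} where
  open Calculus 𝒞

  Prf-resp-≈ : ∀ {S T h} → S ≈ T → Prf S h → Prf T h
  Prf-resp-≈ S≈T prf = relabel (≈-trans (≈-sym S≈T)) prf
    where
      relabel : ∀ {S T h} → (∀ {X} → S ≈ X → T ≈ X) → Prf S h → Prf T h
      relabel f (ax v l e)                = ax v l (f e)
      relabel f (or v P e)                = or v P (f e)
      relabel f (and v P Q e)             = and v P Q (f e)
      relabel f (exR v P e)               = exR v P (f e)
      relabel f (allR v y∉ P e)           = allR v y∉ P (f e)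
      relabel f (diaR v vu r P e)         = diaR v vu r P (f e)
      relabel f (boxR v P e)              = boxR v P (f e)
      relabel f (ref v P e)               = ref v P (f e)
      relabel f (rep v n P e)             = rep v n P (f e)
      relabel f (drep v P e)              = drep v P (f e)
      relabel f (rig v vu w≢u P e)        = rig v vu w≢u P (f e)
      relabel f (dpID a b v vu w≢u r P e)   = dpID a b v vu w≢u r P (f e)
      relabel f (dpDD a b v vu w≢u r P e)   = dpDD a b v vu w≢u r P (f e)
      relabel f (dpIDDD a b v vu w≢u r P e) = dpIDDD a b v vu w≢u r P (f e)
      relabel f (d c v P e)               = d c v P (f e)
      relabel f (nd c v y∉ P e)           = nd c v y∉ P (f e)
      relabel f (cd c v P e)              = cd c v P (f e)

Reach-mono : ∀ {G G′ L w u} → (∀ {p} → Valid p G → Valid p G′) → Reach G L w u → Reach G′ L w u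
Reach-mono {G} {G′} valid (s , s∈L , W) = s , s∈L , walk W
  where
    walk : ∀ {s w u} → Walk G s w u → Walk G′ s w u
    walk nil                = nil
    walk (cons (fwd i v) W) = cons (fwd i (valid v)) (walk W)
    walk (cons (bwd i v) W) = cons (bwd i (valid v)) (walk W)

nest : NSeq → NSeq
nest G = ⟨ [] ∣ [] ∣ [ G ] ⟩

nest-resp-≈ : ∀ {S T} → S ≈ T → nest S ≈ nest T
nest-resp-≈ e = node ↭-refl ↭-refl (Perm.prep e (Perm.refl []))

Reach-nest : ∀ {G L w u} → Reach G L w u → Reach (nest G) L (0 ∷ w) (0 ∷ u)
Reach-nest {G} (s , s∈L , W) = s , s∈L , walk W
  where
    walk : ∀ {s w u} → Walk G s w u → Walk (nest G) s (0 ∷ w) (0 ∷ u)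
    walk nil                = nil
    walk (cons (fwd i v) W) = cons (fwd i (there (vz v))) (walk W)
    walk (cons (bwd i v) W) = cons (bwd i (there (vz v))) (walk W)

FreeS-nest⁻ : ∀ {y G} → FreeS y (nest G) → FreeS y G
FreeS-nest⁻ (inj₂ (inj₂ (inj₁ y∈G))) = y∈G

∷-≢ : ∀ {w u : Path} → w ≢ u → _≢_ {A = Path} (0 ∷ w) (0 ∷ u)
∷-≢ w≢u refl = w≢u refl

module _ {𝒞 : CondSet} where
  open Calculus 𝒞

  Prf-nest : ∀ {S h} → Prf S h → Prf (nest S) h
  Prf-nest (ax v l e) = ax (there (vz v)) l (nest-resp-≈ e)
  Prf-nest (or v P e) = or (there (vz v)) (Prf-nest P) (nest-resp-≈ e)
  Prf-nest (and v P Q e) = and (there (vz v)) (Prf-nest P) (Prf-nest Q) (nest-resp-≈ e)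
  Prf-nest (exR v P e) = exR (there (vz v)) (Prf-nest P) (nest-resp-≈ e)
  Prf-nest (allR v y∉ P e) = allR (there (vz v)) (y∉ ∘ FreeS-nest⁻) (Prf-nest P) (nest-resp-≈ e)
  Prf-nest (diaR v vu r P e) =
    diaR (there (vz v)) (there (vz vu)) (Reach-nest r) (Prf-nest P) (nest-resp-≈ e)
  Prf-nest (boxR v P e) = boxR (there (vz v)) (Prf-nest P) (nest-resp-≈ e)
  Prf-nest (ref v P e) = ref (there (vz v)) (Prf-nest P) (nest-resp-≈ e)
  Prf-nest (rep v n P e) = rep (there (vz v)) n (Prf-nest P) (nest-resp-≈ e)
  Prf-nest (drep v P e) = drep (there (vz v)) (Prf-nest P) (nest-resp-≈ e)
  Prf-nest (rig v vu w≢u P e) =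
    rig (there (vz v)) (there (vz vu)) (∷-≢ w≢u) (Prf-nest P) (nest-resp-≈ e)
  Prf-nest (dpID a b v vu w≢u r P e) =
    dpID a b (there (vz v)) (there (vz vu)) (∷-≢ w≢u) (Reach-nest r) (Prf-nest P) (nest-resp-≈ e)
  Prf-nest (dpDD a b v vu w≢u r P e) =
    dpDD a b (there (vz v)) (there (vz vu)) (∷-≢ w≢u) (Reach-nest r) (Prf-nest P) (nest-resp-≈ e)
  Prf-nest (dpIDDD a b v vu w≢u r P e) =
    dpIDDD a b (there (vz v)) (there (vz vu)) (∷-≢ w≢u) (Reach-nest r) (Prf-nest P) (nest-resp-≈ e)
  Prf-nest (d c v P e) = d c (there (vz v)) (Prf-nest P) (nest-resp-≈ e)
  Prf-nest (nd c v y∉ P e) = nd c (there (vz v)) (y∉ ∘ FreeS-nest⁻) (Prf-nest P) (nest-resp-≈ e)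
  Prf-nest (cd c v P e) = cd c (there (vz v)) (Prf-nest P) (nest-resp-≈ e)

⟨∣∣⟩-cong : ∀ {ts ts′ φs φs′ cs cs′} → ts ≡ ts′ → φs ≡ φs′ → cs ≡ cs′ →
            ⟨ ts ∣ φs ∣ cs ⟩ ≡ ⟨ ts′ ∣ φs′ ∣ cs′ ⟩
⟨∣∣⟩-cong refl refl refl = refl

module Renaming (ρ : ℕ → ℕ) where

  renT : Term → Term
  renT (var x) = var (ρ x)
  renT (con c) = con c

  renFT : ∀ {n} → FTerm n → FTerm n
  renFT (fr u) = fr (renT u)
  renFT (bv i) = bv i

  renFTs : ∀ {n} → List (FTerm n) → List (FTerm n)
  renFTs = map renFT

  renF : ∀ {n} → Fml n → Fml n
  renF (pos P ts) = pos P (renFTs ts)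
  renF (neg P ts) = neg P (renFTs ts)
  renF (eq u s)   = eq (renFT u) (renFT s)
  renF (neq u s)  = neq (renFT u) (renFT s)
  renF (φ ∨ ψ)    = renF φ ∨ renF ψ
  renF (φ ∧ ψ)    = renF φ ∧ renF ψ
  renF (ex φ)     = ex (renF φ)
  renF (all φ)    = all (renF φ)
  renF (dia φ)    = dia (renF φ)
  renF (box φ)    = box (renF φ)

  mutual
    renS : NSeq → NSeq
    renS ⟨ ts ∣ φs ∣ cs ⟩ = ⟨ map renT ts ∣ map renF φs ∣ renSs cs ⟩

    renSs : List NSeq → List NSeq
    renSs []       = []
    renSs (c ∷ cs) = renS c ∷ renSs cs

  renF-dual : ∀ {n} (φ : Fml n) → renF (dual φ) ≡ dual (renF φ)
  renF-dual (pos P ts) = refl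
  renF-dual (neg P ts) = refl
  renF-dual (eq u s)   = refl
  renF-dual (neq u s)  = refl
  renF-dual (φ ∨ ψ)    = cong₂ _∧_ (renF-dual φ) (renF-dual ψ)
  renF-dual (φ ∧ ψ)    = cong₂ _∨_ (renF-dual φ) (renF-dual ψ)
  renF-dual (ex φ)     = cong all (renF-dual φ)
  renF-dual (all φ)    = cong ex (renF-dual φ)
  renF-dual (dia φ)    = cong box (renF-dual φ)
  renF-dual (box φ)    = cong dia (renF-dual φ)

  renFT-openT : ∀ {n} t (u : FTerm (suc n)) → renFT (openT t u) ≡ openT (renT t) (renFT u)
  renFT-openT t (fr u)       = refl
  renFT-openT t (bv zero)    = refl
  renFT-openT t (bv (suc i)) = refl

  renFTs-openTs : ∀ {n} t (us : List (FTerm (suc n))) →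
                  renFTs (openTs t us) ≡ openTs (renT t) (renFTs us)
  renFTs-openTs t []       = refl
  renFTs-openTs t (u ∷ us) = cong₂ _∷_ (renFT-openT t u) (renFTs-openTs t us)

  renF-inst : ∀ {n} (φ : Fml (suc n)) t → renF (inst φ t) ≡ inst (renF φ) (renT t)
  renF-inst (pos P ts) t = cong (pos P) (renFTs-openTs t ts)
  renF-inst (neg P ts) t = cong (neg P) (renFTs-openTs t ts)
  renF-inst (eq u s)   t = cong₂ eq (renFT-openT t u) (renFT-openT t s)
  renF-inst (neq u s)  t = cong₂ neq (renFT-openT t u) (renFT-openT t s)
  renF-inst (φ ∨ ψ)    t = cong₂ _∨_ (renF-inst φ t) (renF-inst ψ t)
  renF-inst (φ ∧ ψ)    t = cong₂ _∧_ (renF-inst φ t) (renF-inst ψ t)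
  renF-inst (ex φ)     t = cong ex (renF-inst φ t)
  renF-inst (all φ)    t = cong all (renF-inst φ t)
  renF-inst (dia φ)    t = cong dia (renF-inst φ t)
  renF-inst (box φ)    t = cong box (renF-inst φ t)

  renSs-++ : ∀ cs ds → renSs (cs ++ ds) ≡ renSs cs ++ renSs ds
  renSs-++ []       ds = refl
  renSs-++ (c ∷ cs) ds = cong (renS c ∷_) (renSs-++ cs ds)

  mutual
    renS-plug : ∀ p G ts φs cs →
                renS (plug G p ts φs cs) ≡ plug (renS G) p (map renT ts) (map renF φs) (renSs cs)
    renS-plug [] ⟨ ts′ ∣ φs′ ∣ cs′ ⟩ ts φs cs =
      ⟨∣∣⟩-cong (List.map-++ renT ts′ ts) (List.map-++ renF φs′ φs) (renSs-++ cs′ cs)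
    renS-plug (i ∷ p) ⟨ ts′ ∣ φs′ ∣ cs′ ⟩ ts φs cs =
      cong ⟨ map renT ts′ ∣ map renF φs′ ∣_⟩ (renSs-modifyL i p cs′ ts φs cs)

    renSs-modifyL : ∀ i p cs′ ts φs cs →
                    renSs (modifyL i p (add ts φs cs) cs′)
                    ≡ modifyL i p (add (map renT ts) (map renF φs) (renSs cs)) (renSs cs′)
    renSs-modifyL i       p []        ts φs cs = refl
    renSs-modifyL zero    p (c ∷ cs′) ts φs cs = cong (_∷ renSs cs′) (renS-plug p c ts φs cs)
    renSs-modifyL (suc i) p (c ∷ cs′) ts φs cs = cong (renS c ∷_) (renSs-modifyL i p cs′ ts φs cs)

  mutual
    Valid-renS : ∀ {p G} → Valid p G → Valid p (renS G)
    Valid-renS here      = here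
    Valid-renS (there v) = there (ValidL-renSs v)

    ValidL-renSs : ∀ {i p cs} → ValidL i p cs → ValidL i p (renSs cs)
    ValidL-renSs (vz v) = vz (Valid-renS v)
    ValidL-renSs (vs v) = vs (ValidL-renSs v)

  mutual
    renS-resp-≈ : ∀ {S T} → S ≈ T → renS S ≈ renS T
    renS-resp-≈ (node a b P) = node (↭.map⁺ renT a) (↭.map⁺ renF b) (renSs-resp-↭≈ P)

    renSs-resp-↭≈ : ∀ {cs ds} → cs ↭≈ ds → renSs cs ↭≈ renSs ds
    renSs-resp-↭≈ (Perm.refl pw)      = Perm.refl (renSs-resp-≈* pw)
    renSs-resp-↭≈ (Perm.prep e P)     = Perm.prep (renS-resp-≈ e) (renSs-resp-↭≈ P)
    renSs-resp-↭≈ (Perm.swap e₁ e₂ P) = Perm.swap (renS-resp-≈ e₁) (renS-resp-≈ e₂) (renSs-resp-↭≈ P)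
    renSs-resp-↭≈ (Perm.trans P Q)    = Perm.trans (renSs-resp-↭≈ P) (renSs-resp-↭≈ Q)

    renSs-resp-≈* : ∀ {cs ds} → Pointwise _≈_ cs ds → Pointwise _≈_ (renSs cs) (renSs ds)
    renSs-resp-≈* []       = []
    renSs-resp-≈* (e ∷ pw) = renS-resp-≈ e ∷ renSs-resp-≈* pw

  Literal-renF : ∀ {L} → Literal L → Literal (renF L)
  Literal-renF (lpos P ts) = lpos P _
  Literal-renF (lneg P ts) = lneg P _
  Literal-renF (leq t s)   = leq _ _
  Literal-renF (lneq t s)  = lneq _ _

  NegLiteral-renF : ∀ {L} → NegLiteral L → NegLiteral (renF L)
  NegLiteral-renF (nneg P ts) = nneg P _
  NegLiteral-renF (nneq t s)  = nneq _ _

  var-injective : ∀ {x y} → var x ≡ var y → x ≡ y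
  var-injective refl = refl

  module _ (ρ-inj : Injective _≡_ _≡_ ρ) where

    renT-substTm : ∀ z t u → renT (substTm z t u) ≡ substTm (ρ z) (renT t) (renT u)
    renT-substTm z t (con c) = refl
    renT-substTm z t (var x) with x ≟ z | ρ x ≟ ρ z
    ... | yes _   | yes _   = refl
    ... | yes x≡z | no ρx≢ρz = ⊥-elim (ρx≢ρz (cong ρ x≡z))
    ... | no x≢z  | yes ρx≡ρz = ⊥-elim (x≢z (ρ-inj ρx≡ρz))
    ... | no _    | no _    = refl

    renFT-substFT : ∀ {n} z t (u : FTerm n) → renFT (substFT z t u) ≡ substFT (ρ z) (renT t) (renFT u)
    renFT-substFT z t (fr u) = cong fr (renT-substTm z t u)
    renFT-substFT z t (bv i) = refl

    renFTs-substFTs : ∀ {n} z t (us : List (FTerm n)) →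
                      renFTs (substFTs z t us) ≡ substFTs (ρ z) (renT t) (renFTs us)
    renFTs-substFTs z t []       = refl
    renFTs-substFTs z t (u ∷ us) = cong₂ _∷_ (renFT-substFT z t u) (renFTs-substFTs z t us)

    renF-subst : ∀ {n} (φ : Fml n) t z → renF (subst φ t z) ≡ subst (renF φ) (renT t) (ρ z)
    renF-subst (pos P ts) t z = cong (pos P) (renFTs-substFTs z t ts)
    renF-subst (neg P ts) t z = cong (neg P) (renFTs-substFTs z t ts)
    renF-subst (eq u s)   t z = cong₂ eq (renFT-substFT z t u) (renFT-substFT z t s)
    renF-subst (neq u s)  t z = cong₂ neq (renFT-substFT z t u) (renFT-substFT z t s)
    renF-subst (φ ∨ ψ)    t z = cong₂ _∨_ (renF-subst φ t z) (renF-subst ψ t z)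
    renF-subst (φ ∧ ψ)    t z = cong₂ _∧_ (renF-subst φ t z) (renF-subst ψ t z)
    renF-subst (ex φ)     t z = cong ex (renF-subst φ t z)
    renF-subst (all φ)    t z = cong all (renF-subst φ t z)
    renF-subst (dia φ)    t z = cong dia (renF-subst φ t z)
    renF-subst (box φ)    t z = cong box (renF-subst φ t z)

    renT-var⁻ : ∀ {y} u → renT u ≡ var (ρ y) → u ≡ var y
    renT-var⁻ (var x) e = cong var (ρ-inj (var-injective e))
    renT-var⁻ (con c) ()

    FreeFT-renFT⁻ : ∀ {n y} (u : FTerm n) → FreeFT (ρ y) (renFT u) → FreeFT y u
    FreeFT-renFT⁻ (fr u) y∈u = renT-var⁻ u y∈u

    FreeFTs-renFTs⁻ : ∀ {n y} {us : List (FTerm n)} → Any (FreeFT (ρ y)) (renFTs us) → Any (FreeFT y) us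
    FreeFTs-renFTs⁻ y∈us = Any.map (λ {u} → FreeFT-renFT⁻ u) (AnyP.map⁻ y∈us)

    FreeF-renF⁻ : ∀ {n y} (φ : Fml n) → FreeF (ρ y) (renF φ) → FreeF y φ
    FreeF-renF⁻ (pos P ts) f        = FreeFTs-renFTs⁻ f
    FreeF-renF⁻ (neg P ts) f        = FreeFTs-renFTs⁻ f
    FreeF-renF⁻ (eq u s)   (inj₁ f) = inj₁ (FreeFT-renFT⁻ u f)
    FreeF-renF⁻ (eq u s)   (inj₂ f) = inj₂ (FreeFT-renFT⁻ s f)
    FreeF-renF⁻ (neq u s)  (inj₁ f) = inj₁ (FreeFT-renFT⁻ u f)
    FreeF-renF⁻ (neq u s)  (inj₂ f) = inj₂ (FreeFT-renFT⁻ s f)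
    FreeF-renF⁻ (φ ∨ ψ)    (inj₁ f) = inj₁ (FreeF-renF⁻ φ f)
    FreeF-renF⁻ (φ ∨ ψ)    (inj₂ f) = inj₂ (FreeF-renF⁻ ψ f)
    FreeF-renF⁻ (φ ∧ ψ)    (inj₁ f) = inj₁ (FreeF-renF⁻ φ f)
    FreeF-renF⁻ (φ ∧ ψ)    (inj₂ f) = inj₂ (FreeF-renF⁻ ψ f)
    FreeF-renF⁻ (ex φ)     f        = FreeF-renF⁻ φ f
    FreeF-renF⁻ (all φ)    f        = FreeF-renF⁻ φ f
    FreeF-renF⁻ (dia φ)    f        = FreeF-renF⁻ φ f
    FreeF-renF⁻ (box φ)    f        = FreeF-renF⁻ φ f

    mutual
      FreeS-renS⁻ : ∀ {y} S → FreeS (ρ y) (renS S) → FreeS y S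
      FreeS-renS⁻ ⟨ ts ∣ φs ∣ cs ⟩ (inj₁ y∈ts) =
        inj₁ (Any.map (λ {u} → renT-var⁻ u) (AnyP.map⁻ y∈ts))
      FreeS-renS⁻ ⟨ ts ∣ φs ∣ cs ⟩ (inj₂ (inj₁ y∈φs)) =
        inj₂ (inj₁ (Any.map (λ {φ} → FreeF-renF⁻ φ) (AnyP.map⁻ y∈φs)))
      FreeS-renS⁻ ⟨ ts ∣ φs ∣ cs ⟩ (inj₂ (inj₂ y∈cs)) = inj₂ (inj₂ (FreeSs-renSs⁻ cs y∈cs))

      FreeSs-renSs⁻ : ∀ {y} cs → FreeSL (ρ y) (renSs cs) → FreeSL y cs
      FreeSs-renSs⁻ (c ∷ cs) (inj₁ y∈c)  = inj₁ (FreeS-renS⁻ c y∈c)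
      FreeSs-renSs⁻ (c ∷ cs) (inj₂ y∈cs) = inj₂ (FreeSs-renSs⁻ cs y∈cs)

    ∉FreeS-renS : ∀ {y} S → ¬ FreeS y S → ¬ FreeS (ρ y) (renS S)
    ∉FreeS-renS S y∉S = y∉S ∘ FreeS-renS⁻ S

  map-identity : ∀ {A : Set} {Free : ℕ → A → Set} {f : A → A} →
                 (∀ a → (∀ {x} → Free x a → ρ x ≡ x) → f a ≡ a) →
                 ∀ as → (∀ {x} → Any (Free x) as → ρ x ≡ x) → map f as ≡ as
  map-identity f-id []       fix = refl
  map-identity f-id (a ∷ as) fix =
    cong₂ _∷_ (f-id a (λ x∈a → fix (here x∈a))) (map-identity f-id as (λ x∈as → fix (there x∈as)))

  renT-identity : ∀ u → (∀ {x} → u ≡ var x → ρ x ≡ x) → renT u ≡ u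
  renT-identity (var x) fix = cong var (fix refl)
  renT-identity (con c) fix = refl

  renFT-identity : ∀ {n} (u : FTerm n) → (∀ {x} → FreeFT x u → ρ x ≡ x) → renFT u ≡ u
  renFT-identity (fr u) fix = cong fr (renT-identity u fix)
  renFT-identity (bv i) fix = refl

  renF-identity : ∀ {n} (φ : Fml n) → (∀ {x} → FreeF x φ → ρ x ≡ x) → renF φ ≡ φ
  renF-identity (pos P ts) fix = cong (pos P) (map-identity renFT-identity ts fix)
  renF-identity (neg P ts) fix = cong (neg P) (map-identity renFT-identity ts fix)
  renF-identity (eq u s)   fix =
    cong₂ eq (renFT-identity u (λ f → fix (inj₁ f))) (renFT-identity s (λ f → fix (inj₂ f)))
  renF-identity (neq u s)  fix =
    cong₂ neq (renFT-identity u (λ f → fix (inj₁ f))) (renFT-identity s (λ f → fix (inj₂ f)))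
  renF-identity (φ ∨ ψ)    fix =
    cong₂ _∨_ (renF-identity φ (λ f → fix (inj₁ f))) (renF-identity ψ (λ f → fix (inj₂ f)))
  renF-identity (φ ∧ ψ)    fix =
    cong₂ _∧_ (renF-identity φ (λ f → fix (inj₁ f))) (renF-identity ψ (λ f → fix (inj₂ f)))
  renF-identity (ex φ)     fix = cong ex (renF-identity φ fix)
  renF-identity (all φ)    fix = cong all (renF-identity φ fix)
  renF-identity (dia φ)    fix = cong dia (renF-identity φ fix)
  renF-identity (box φ)    fix = cong box (renF-identity φ fix)

  mutual
    renS-identity : ∀ S → (∀ {x} → FreeS x S → ρ x ≡ x) → renS S ≡ S
    renS-identity ⟨ ts ∣ φs ∣ cs ⟩ fix =
      ⟨∣∣⟩-cong (map-identity renT-identity ts (λ f → fix (inj₁ f)))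
                (map-identity renF-identity φs (λ f → fix (inj₂ (inj₁ f))))
                (renSs-identity cs (λ f → fix (inj₂ (inj₂ f))))

    renSs-identity : ∀ cs → (∀ {x} → FreeSL x cs → ρ x ≡ x) → renSs cs ≡ cs
    renSs-identity []       fix = refl
    renSs-identity (c ∷ cs) fix =
      cong₂ _∷_ (renS-identity c (λ f → fix (inj₁ f))) (renSs-identity cs (λ f → fix (inj₂ f)))

module _ {𝒞 : CondSet} {ρ : ℕ → ℕ} (ρ-inj : Injective _≡_ _≡_ ρ) where
  open Calculus 𝒞
  open Renaming ρ

  private
    renamed-≈ : ∀ {S G X} p ts φs cs → S ≈ plug G p ts φs cs →
                plug (renS G) p (map renT ts) (map renF φs) (renSs cs) ≡ X → renS S ≈ X
    renamed-≈ {G = G} p ts φs cs e q =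
      ≈-trans (renS-resp-≈ e) (≈-reflexive (trans (renS-plug p G ts φs cs) q))

    renamed-Prf : ∀ {G X h} p ts φs cs → Prf (renS (plug G p ts φs cs)) h →
                  plug (renS G) p (map renT ts) (map renF φs) (renSs cs) ≡ X → Prf X h
    renamed-Prf {G = G} p ts φs cs P q =
      Eq.subst (λ S → Prf S _) (trans (renS-plug p G ts φs cs) q) P

    renamed-Prf₂ : ∀ {G h} u ts₁ φs₁ w ts₂ φs₂ →
                   Prf (renS (plug (plug G u ts₁ φs₁ []) w ts₂ φs₂ [])) h →
                   Prf (plug (plug (renS G) u (map renT ts₁) (map renF φs₁) []) w
                             (map renT ts₂) (map renF φs₂) []) h
    renamed-Prf₂ {G} u ts₁ φs₁ w ts₂ φs₂ P =
      renamed-Prf w ts₂ φs₂ [] P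
        (cong (λ Z → plug Z w (map renT ts₂) (map renF φs₂) []) (renS-plug u G ts₁ φs₁ []))

  Prf-rename : ∀ {S h} → Prf S h → Prf (renS S) h
  Prf-rename (ax {p = p} {L = L} v l e) =
    ax (Valid-renS v) (Literal-renF l)
       (renamed-≈ p [] (L ∷ dual L ∷ []) [] e (cong (λ L̄ → plugF _ p (renF L ∷ L̄ ∷ [])) (renF-dual L)))
  Prf-rename (or {p = p} {φ = φ} {ψ = ψ} v P e) =
    or (Valid-renS v) (renamed-Prf p [] (φ ∷ ψ ∷ []) [] (Prf-rename P) refl)
       (renamed-≈ p [] [ φ ∨ ψ ] [] e refl)
  Prf-rename (and {p = p} {φ = φ} {ψ = ψ} v P Q e) =
    and (Valid-renS v) (renamed-Prf p [] [ φ ] [] (Prf-rename P) refl)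
        (renamed-Prf p [] [ ψ ] [] (Prf-rename Q) refl) (renamed-≈ p [] [ φ ∧ ψ ] [] e refl)
  Prf-rename (exR {p = p} {t = t} {ψ = ψ} v P e) =
    exR (Valid-renS v)
        (renamed-Prf p [ t ] (ex ψ ∷ inst ψ t ∷ []) [] (Prf-rename P)
          (cong (λ χ → plug _ p [ renT t ] (ex (renF ψ) ∷ χ ∷ []) []) (renF-inst ψ t)))
        (renamed-≈ p [ t ] [ ex ψ ] [] e refl)
  Prf-rename (allR {G = G} {p = p} {φ = φ} {y = y} v y∉ P e) =
    allR (Valid-renS v)
         (Eq.subst (λ C → ¬ FreeS (ρ y) C) (renS-plug p G [] [ all φ ] [])
           (∉FreeS-renS ρ-inj (plugF G p [ all φ ]) y∉))
         (renamed-Prf p [ var y ] [ inst φ (var y) ] [] (Prf-rename P)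
           (cong (λ χ → plug _ p [ var (ρ y) ] [ χ ] []) (renF-inst φ (var y))))
         (renamed-≈ p [] [ all φ ] [] e refl)
  Prf-rename (diaR {w = w} {u = u} {φ = φ} v vu r P e) =
    diaR (Valid-renS v) (Valid-renS vu) (Reach-mono Valid-renS r)
         (renamed-Prf₂ u [] [ φ ] w [] [ dia φ ] (Prf-rename P)) (renamed-≈ w [] [ dia φ ] [] e refl)
  Prf-rename (boxR {p = p} {φ = φ} v P e) =
    boxR (Valid-renS v) (renamed-Prf p [] [] [ ⟨ [] ∣ [ φ ] ∣ [] ⟩ ] (Prf-rename P) refl)
         (renamed-≈ p [] [ box φ ] [] e refl)
  Prf-rename (ref {p = p} {t = t} v P e) =
    ref (Valid-renS v) (renamed-Prf p [] [ neq (fr t) (fr t) ] [] (Prf-rename P) refl) (renS-resp-≈ e)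
  Prf-rename (rep {p = p} {t = t} {s = s} {N = N} {z = z} v n P e) =
    rep (Valid-renS v) (NegLiteral-renF n)
        (renamed-Prf p [] (t≠s ∷ subst N t z ∷ subst N s z ∷ []) [] (Prf-rename P)
          (cong₂ (λ Nt Ns → plugF _ p (renF t≠s ∷ Nt ∷ Ns ∷ [])) (renF-subst ρ-inj N t z) (renF-subst ρ-inj N s z)))
        (renamed-≈ p [] (t≠s ∷ subst N t z ∷ []) [] e
          (cong (λ Nt → plugF _ p (renF t≠s ∷ Nt ∷ [])) (renF-subst ρ-inj N t z)))
    where t≠s = neq (fr t) (fr s)
  Prf-rename (drep {p = p} {t = t} {s = s} v P e) =
    drep (Valid-renS v) (renamed-Prf p (s ∷ t ∷ []) [ neq (fr t) (fr s) ] [] (Prf-rename P) refl)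
         (renamed-≈ p [ t ] [ neq (fr t) (fr s) ] [] e refl)
  Prf-rename (rig {w = w} {u = u} {s = s} {t = t} v vu w≢u P e) =
    rig (Valid-renS v) (Valid-renS vu) w≢u
        (renamed-Prf₂ u [] [ neq (fr s) (fr t) ] w [] [ neq (fr s) (fr t) ] (Prf-rename P))
        (renamed-≈ w [] [ neq (fr s) (fr t) ] [] e refl)
  Prf-rename (dpID {w = w} {u = u} {t = t} a b v vu w≢u r P e) =
    dpID a b (Valid-renS v) (Valid-renS vu) w≢u (Reach-mono Valid-renS r)
         (renamed-Prf₂ u [ t ] [] w [ t ] [] (Prf-rename P)) (renamed-≈ w [ t ] [] [] e refl)
  Prf-rename (dpDD {w = w} {u = u} {t = t} a b v vu w≢u r P e) =
    dpDD a b (Valid-renS v) (Valid-renS vu) w≢u (Reach-mono Valid-renS r)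
         (renamed-Prf₂ u [ t ] [] w [ t ] [] (Prf-rename P)) (renamed-≈ w [ t ] [] [] e refl)
  Prf-rename (dpIDDD {w = w} {u = u} {t = t} a b v vu w≢u r P e) =
    dpIDDD a b (Valid-renS v) (Valid-renS vu) w≢u (Reach-mono Valid-renS r)
           (renamed-Prf₂ u [ t ] [] w [ t ] [] (Prf-rename P)) (renamed-≈ w [ t ] [] [] e refl)
  Prf-rename (d {p = p} c v P e) =
    d c (Valid-renS v) (renamed-Prf p [] [] [ emptyS ] (Prf-rename P) refl) (renS-resp-≈ e)
  Prf-rename (nd {G = G} {p = p} {y = y} c v y∉ P e) =
    nd c (Valid-renS v) (∉FreeS-renS ρ-inj G y∉) (renamed-Prf p [ var y ] [] [] (Prf-rename P) refl)
       (renS-resp-≈ e)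
  Prf-rename (cd {p = p} {t = t} c v P e) =
    cd c (Valid-renS v) (renamed-Prf p [ t ] [] [] (Prf-rename P) refl) (renS-resp-≈ e)

<-⊔ˡ : ∀ {y a} b → y < a → y < a ⊔ b
<-⊔ˡ {a = a} b y<a = ≤-trans y<a (m≤m⊔n a b)

<-⊔ʳ : ∀ {y} a {b} → y < b → y < a ⊔ b
<-⊔ʳ a {b} y<b = ≤-trans y<b (m≤n⊔m a b)

maxOver : ∀ {A : Set} → (A → ℕ) → List A → ℕ
maxOver f []       = 0
maxOver f (a ∷ as) = f a ⊔ maxOver f as

Any⇒<maxOver : ∀ {A : Set} {P : A → Set} {f : A → ℕ} {y} →
               (∀ {a} → P a → y < f a) → ∀ {as} → Any P as → y < maxOver f as
Any⇒<maxOver {f = f} bound {a ∷ as} (here pa)   = <-⊔ˡ (maxOver f as) (bound pa)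
Any⇒<maxOver {f = f} bound {a ∷ as} (there pas) = <-⊔ʳ (f a) (Any⇒<maxOver bound pas)

varBoundT : Term → ℕ
varBoundT (var x) = suc x
varBoundT (con c) = 0

varBoundFT : ∀ {n} → FTerm n → ℕ
varBoundFT (fr u) = varBoundT u
varBoundFT (bv i) = 0

varBoundF : ∀ {n} → Fml n → ℕ
varBoundF (pos P ts) = maxOver varBoundFT ts
varBoundF (neg P ts) = maxOver varBoundFT ts
varBoundF (eq u s)   = varBoundFT u ⊔ varBoundFT s
varBoundF (neq u s)  = varBoundFT u ⊔ varBoundFT s
varBoundF (φ ∨ ψ)    = varBoundF φ ⊔ varBoundF ψ
varBoundF (φ ∧ ψ)    = varBoundF φ ⊔ varBoundF ψ
varBoundF (ex φ)     = varBoundF φ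
varBoundF (all φ)    = varBoundF φ
varBoundF (dia φ)    = varBoundF φ
varBoundF (box φ)    = varBoundF φ

mutual
  varBound : NSeq → ℕ
  varBound ⟨ ts ∣ φs ∣ cs ⟩ = maxOver varBoundT ts ⊔ (maxOver varBoundF φs ⊔ varBounds cs)

  varBounds : List NSeq → ℕ
  varBounds []       = 0
  varBounds (c ∷ cs) = varBound c ⊔ varBounds cs

FreeT⇒<varBoundT : ∀ {y u} → u ≡ var y → y < varBoundT u
FreeT⇒<varBoundT refl = ≤-refl

FreeFT⇒<varBoundFT : ∀ {n y} (u : FTerm n) → FreeFT y u → y < varBoundFT u
FreeFT⇒<varBoundFT (fr u) y∈u = FreeT⇒<varBoundT y∈u

FreeF⇒<varBoundF : ∀ {n y} (φ : Fml n) → FreeF y φ → y < varBoundF φ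
FreeF⇒<varBoundF (pos P ts) f        = Any⇒<maxOver (λ {u} → FreeFT⇒<varBoundFT u) f
FreeF⇒<varBoundF (neg P ts) f        = Any⇒<maxOver (λ {u} → FreeFT⇒<varBoundFT u) f
FreeF⇒<varBoundF (eq u s)   (inj₁ f) = <-⊔ˡ (varBoundFT s) (FreeFT⇒<varBoundFT u f)
FreeF⇒<varBoundF (eq u s)   (inj₂ f) = <-⊔ʳ (varBoundFT u) (FreeFT⇒<varBoundFT s f)
FreeF⇒<varBoundF (neq u s)  (inj₁ f) = <-⊔ˡ (varBoundFT s) (FreeFT⇒<varBoundFT u f)
FreeF⇒<varBoundF (neq u s)  (inj₂ f) = <-⊔ʳ (varBoundFT u) (FreeFT⇒<varBoundFT s f)
FreeF⇒<varBoundF (φ ∨ ψ)    (inj₁ f) = <-⊔ˡ (varBoundF ψ) (FreeF⇒<varBoundF φ f)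
FreeF⇒<varBoundF (φ ∨ ψ)    (inj₂ f) = <-⊔ʳ (varBoundF φ) (FreeF⇒<varBoundF ψ f)
FreeF⇒<varBoundF (φ ∧ ψ)    (inj₁ f) = <-⊔ˡ (varBoundF ψ) (FreeF⇒<varBoundF φ f)
FreeF⇒<varBoundF (φ ∧ ψ)    (inj₂ f) = <-⊔ʳ (varBoundF φ) (FreeF⇒<varBoundF ψ f)
FreeF⇒<varBoundF (ex φ)     f        = FreeF⇒<varBoundF φ f
FreeF⇒<varBoundF (all φ)    f        = FreeF⇒<varBoundF φ f
FreeF⇒<varBoundF (dia φ)    f        = FreeF⇒<varBoundF φ f
FreeF⇒<varBoundF (box φ)    f        = FreeF⇒<varBoundF φ f

mutual
  FreeS⇒<varBound : ∀ {y} S → FreeS y S → y < varBound S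
  FreeS⇒<varBound ⟨ ts ∣ φs ∣ cs ⟩ (inj₁ f) =
    <-⊔ˡ (maxOver varBoundF φs ⊔ varBounds cs) (Any⇒<maxOver FreeT⇒<varBoundT f)
  FreeS⇒<varBound ⟨ ts ∣ φs ∣ cs ⟩ (inj₂ (inj₁ f)) =
    <-⊔ʳ (maxOver varBoundT ts) (<-⊔ˡ (varBounds cs) (Any⇒<maxOver (λ {φ} → FreeF⇒<varBoundF φ) f))
  FreeS⇒<varBound ⟨ ts ∣ φs ∣ cs ⟩ (inj₂ (inj₂ f)) =
    <-⊔ʳ (maxOver varBoundT ts) (<-⊔ʳ (maxOver varBoundF φs) (FreeSs⇒<varBounds cs f))

  FreeSs⇒<varBounds : ∀ {y} cs → FreeSL y cs → y < varBounds cs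
  FreeSs⇒<varBounds (c ∷ cs) (inj₁ f) = <-⊔ˡ (varBounds cs) (FreeS⇒<varBound c f)
  FreeSs⇒<varBounds (c ∷ cs) (inj₂ f) = <-⊔ʳ (varBound c) (FreeSs⇒<varBounds cs f)

varBound-fresh : ∀ S → ¬ FreeS (varBound S) S
varBound-fresh S f = <-irrefl refl (FreeS⇒<varBound S f)

FreeSL-++ˡ : ∀ {y cs ds} → FreeSL y cs → FreeSL y (cs ++ ds)
FreeSL-++ˡ {cs = c ∷ cs} (inj₁ y∈c)  = inj₁ y∈c
FreeSL-++ˡ {cs = c ∷ cs} (inj₂ y∈cs) = inj₂ (FreeSL-++ˡ y∈cs)

FreeSL-++ʳ : ∀ {y} cs {ds} → FreeSL y ds → FreeSL y (cs ++ ds)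
FreeSL-++ʳ []       y∈ds = y∈ds
FreeSL-++ʳ (c ∷ cs) y∈ds = inj₂ (FreeSL-++ʳ cs y∈ds)

ValidL-++ : ∀ {i p cs} ds → ValidL i p cs → ValidL i p (cs ++ ds)
ValidL-++ ds (vz v) = vz v
ValidL-++ ds (vs v) = vs (ValidL-++ ds v)

modifyL-++ : ∀ {i p cs} f ds → ValidL i p cs → modifyL i p f (cs ++ ds) ≡ modifyL i p f cs ++ ds
modifyL-++ f ds (vz v) = refl
modifyL-++ f ds (vs v) = cong (_ ∷_) (modifyL-++ f ds v)

mutual
  FreeS-plug-hole : ∀ {y p G} ts φs cs → Valid p G → FreeS y ⟨ ts ∣ φs ∣ cs ⟩ → FreeS y (plug G p ts φs cs)
  FreeS-plug-hole {G = ⟨ ts′ ∣ φs′ ∣ cs′ ⟩} ts φs cs here (inj₁ y∈ts) = inj₁ (AnyP.++⁺ʳ ts′ y∈ts)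
  FreeS-plug-hole {G = ⟨ ts′ ∣ φs′ ∣ cs′ ⟩} ts φs cs here (inj₂ (inj₁ y∈φs)) = inj₂ (inj₁ (AnyP.++⁺ʳ φs′ y∈φs))
  FreeS-plug-hole {G = ⟨ ts′ ∣ φs′ ∣ cs′ ⟩} ts φs cs here (inj₂ (inj₂ y∈cs)) = inj₂ (inj₂ (FreeSL-++ʳ cs′ y∈cs))
  FreeS-plug-hole ts φs cs (there v) y∈ = inj₂ (inj₂ (FreeSL-modifyL-hole ts φs cs v y∈))

  FreeSL-modifyL-hole : ∀ {y i p cs′} ts φs cs → ValidL i p cs′ → FreeS y ⟨ ts ∣ φs ∣ cs ⟩ →
                        FreeSL y (modifyL i p (add ts φs cs) cs′)
  FreeSL-modifyL-hole ts φs cs (vz v) y∈ = inj₁ (FreeS-plug-hole ts φs cs v y∈)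
  FreeSL-modifyL-hole ts φs cs (vs v) y∈ = inj₂ (FreeSL-modifyL-hole ts φs cs v y∈)

-- The children equation is a separate argument so that matching on extend never unifies with _++_.
data _⊑_ : NSeq → NSeq → Set where
  extend : ∀ {ts φs cs ts′ φs′ ds cs′} (ets : List Term) (eφs : List Formula) (ecs : List NSeq) →
           ts′ ↭ ts ++ ets → φs′ ↭ φs ++ eφs → Pointwise _⊑_ cs ds → cs′ ≡ ds ++ ecs →
           ⟨ ts ∣ φs ∣ cs ⟩ ⊑ ⟨ ts′ ∣ φs′ ∣ cs′ ⟩

mutual
  ⊑-refl : ∀ {S} → S ⊑ S
  ⊑-refl {⟨ ts ∣ φs ∣ cs ⟩} =
    extend [] [] [] (↭-sym (↭.++-identityʳ ts)) (↭-sym (↭.++-identityʳ φs)) ⊑*-refl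
           (sym (List.++-identityʳ cs))

  ⊑*-refl : ∀ {cs} → Pointwise _⊑_ cs cs
  ⊑*-refl {[]}     = []
  ⊑*-refl {c ∷ cs} = ⊑-refl ∷ ⊑*-refl

mutual
  Valid-⊑ : ∀ {G G′ p} → G ⊑ G′ → Valid p G → Valid p G′
  Valid-⊑ E here = here
  Valid-⊑ (extend _ _ ecs _ _ E* refl) (there v) = there (ValidL-++ ecs (ValidL-⊑* E* v))

  ValidL-⊑* : ∀ {cs ds i p} → Pointwise _⊑_ cs ds → ValidL i p cs → ValidL i p ds
  ValidL-⊑* (E ∷ E*) (vz v) = vz (Valid-⊑ E v)
  ValidL-⊑* (E ∷ E*) (vs v) = vs (ValidL-⊑* E* v)

mutual
  FreeS-⊑ : ∀ {y G G′} → G ⊑ G′ → FreeS y G → FreeS y G′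
  FreeS-⊑ (extend _ _ _ ts↭ _ _ refl) (inj₁ y∈ts) =
    inj₁ (↭.Any-resp-↭ (↭-sym ts↭) (AnyP.++⁺ˡ y∈ts))
  FreeS-⊑ (extend _ _ _ _ φs↭ _ refl) (inj₂ (inj₁ y∈φs)) =
    inj₂ (inj₁ (↭.Any-resp-↭ (↭-sym φs↭) (AnyP.++⁺ˡ y∈φs)))
  FreeS-⊑ (extend _ _ _ _ _ E* refl) (inj₂ (inj₂ y∈cs)) = inj₂ (inj₂ (FreeSL-++ˡ (FreeSL-⊑* E* y∈cs)))

  FreeSL-⊑* : ∀ {y cs ds} → Pointwise _⊑_ cs ds → FreeSL y cs → FreeSL y ds
  FreeSL-⊑* (E ∷ E*) (inj₁ y∈c)  = inj₁ (FreeS-⊑ E y∈c)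
  FreeSL-⊑* (E ∷ E*) (inj₂ y∈cs) = inj₂ (FreeSL-⊑* E* y∈cs)

mutual
  ≈-⊑-commute : ∀ {S A T} → S ≈ A → S ⊑ T → Σ NSeq λ B → A ⊑ B × T ≈ B
  ≈-⊑-commute (node ts↭ φs↭ cs↭≈) (extend {ts′ = ts′} {φs′ = φs′} ets eφs ecs ts′↭ φs′↭ E* refl)
    with ↭≈-⊑*-commute cs↭≈ E*
  ... | ads , EA* , ds↭≈ads =
    ⟨ ts′ ∣ φs′ ∣ ads ++ ecs ⟩ ,
    extend ets eφs ecs (↭-trans ts′↭ (↭.++⁺ʳ ets ts↭)) (↭-trans φs′↭ (↭.++⁺ʳ eφs φs↭)) EA* refl ,
    node ↭-refl ↭-refl (↭≈-++ʳ ecs ds↭≈ads)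

  ↭≈-⊑*-commute : ∀ {cs acs ds} → cs ↭≈ acs → Pointwise _⊑_ cs ds →
                  Σ (List NSeq) λ ads → Pointwise _⊑_ acs ads × ds ↭≈ ads
  ↭≈-⊑*-commute (Perm.refl pw) E* with ≈*-⊑*-commute pw E*
  ... | ads , EA* , pw′ = ads , EA* , Perm.refl pw′
  ↭≈-⊑*-commute (Perm.prep e P) (E ∷ E*) with ≈-⊑-commute e E | ↭≈-⊑*-commute P E*
  ... | b , EA , e′ | ads , EA* , P′ = b ∷ ads , EA ∷ EA* , Perm.prep e′ P′
  ↭≈-⊑*-commute (Perm.swap e₁ e₂ P) (E₁ ∷ E₂ ∷ E*)
    with ≈-⊑-commute e₁ E₁ | ≈-⊑-commute e₂ E₂ | ↭≈-⊑*-commute P E*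
  ... | b₁ , EA₁ , e₁′ | b₂ , EA₂ , e₂′ | ads , EA* , P′ =
    b₂ ∷ b₁ ∷ ads , EA₂ ∷ EA₁ ∷ EA* , Perm.swap e₁′ e₂′ P′
  ↭≈-⊑*-commute (Perm.trans P Q) E* with ↭≈-⊑*-commute P E*
  ... | ads , EA* , P′ with ↭≈-⊑*-commute Q EA*
  ...   | bds , EB* , Q′ = bds , EB* , Perm.trans P′ Q′

  ≈*-⊑*-commute : ∀ {cs acs ds} → Pointwise _≈_ cs acs → Pointwise _⊑_ cs ds →
                  Σ (List NSeq) λ ads → Pointwise _⊑_ acs ads × Pointwise _≈_ ds ads
  ≈*-⊑*-commute [] [] = [] , [] , []
  ≈*-⊑*-commute (e ∷ pw) (E ∷ E*) with ≈-⊑-commute e E | ≈*-⊑*-commute pw E*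
  ... | b , EA , e′ | ads , EA* , pw′ = b ∷ ads , EA ∷ EA* , e′ ∷ pw′

mutual
  ⊑-plug : ∀ {G} p ts φs cs → Valid p G → G ⊑ plug G p ts φs cs
  ⊑-plug {⟨ gts ∣ gφs ∣ gcs ⟩} [] ts φs cs here = extend ts φs cs ↭-refl ↭-refl ⊑*-refl refl
  ⊑-plug {⟨ gts ∣ gφs ∣ gcs ⟩} (i ∷ p) ts φs cs (there v) =
    extend [] [] [] (↭-sym (↭.++-identityʳ gts)) (↭-sym (↭.++-identityʳ gφs)) (⊑*-modifyL i p ts φs cs v)
           (sym (List.++-identityʳ _))

  ⊑*-modifyL : ∀ {cs′} i p ts φs cs → ValidL i p cs′ → Pointwise _⊑_ cs′ (modifyL i p (add ts φs cs) cs′)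
  ⊑*-modifyL zero    p ts φs cs (vz v) = ⊑-plug p ts φs cs v ∷ ⊑*-refl
  ⊑*-modifyL (suc i) p ts φs cs (vs v) = ⊑-refl ∷ ⊑*-modifyL i p ts φs cs v

mutual
  plug-mono-⊑ : ∀ {G G′} p ts φs → G ⊑ G′ → Valid p G → plug G p ts φs [] ⊑ plug G′ p ts φs []
  plug-mono-⊑ {⟨ gts ∣ gφs ∣ gcs ⟩} [] ts φs (extend {ds = ds} ets eφs ecs ts′↭ φs′↭ E* refl) here =
    extend ets eφs ecs (↭-trans (↭.++⁺ʳ ts ts′↭) (↭-swap-tails gts ets ts))
           (↭-trans (↭.++⁺ʳ φs φs′↭) (↭-swap-tails gφs eφs φs))
           (Eq.subst (λ cs → Pointwise _⊑_ cs ds) (sym (List.++-identityʳ gcs)) E*)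
           (List.++-identityʳ (ds ++ ecs))
  plug-mono-⊑ (i ∷ p) ts φs (extend ets eφs ecs ts′↭ φs′↭ E* refl) (there v) =
    extend ets eφs ecs ts′↭ φs′↭ (modifyL-mono-⊑* i p ts φs E* v)
           (modifyL-++ (add ts φs []) ecs (ValidL-⊑* E* v))

  modifyL-mono-⊑* : ∀ {cs ds} i p ts φs → Pointwise _⊑_ cs ds → ValidL i p cs →
                    Pointwise _⊑_ (modifyL i p (add ts φs []) cs) (modifyL i p (add ts φs []) ds)
  modifyL-mono-⊑* zero    p ts φs (E ∷ E*) (vz v) = plug-mono-⊑ p ts φs E v ∷ E*
  modifyL-mono-⊑* (suc i) p ts φs (E ∷ E*) (vs v) = E ∷ modifyL-mono-⊑* i p ts φs E* v

-- With new children the extension only holds up to ≈: they land before the extension's children.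
mutual
  plug-mono-⊑-≈ : ∀ {G G′} p ts φs cs → G ⊑ G′ → Valid p G →
                  Σ NSeq λ B → plug G p ts φs cs ⊑ B × B ≈ plug G′ p ts φs cs
  plug-mono-⊑-≈ {⟨ gts ∣ gφs ∣ gcs ⟩} {⟨ gts′ ∣ gφs′ ∣ _ ⟩} [] ts φs cs
                (extend {ds = ds} ets eφs ecs ts′↭ φs′↭ E* refl) here =
    ⟨ gts′ ++ ts ∣ gφs′ ++ φs ∣ (ds ++ cs) ++ ecs ⟩ ,
    extend ets eφs ecs (↭-trans (↭.++⁺ʳ ts ts′↭) (↭-swap-tails gts ets ts))
           (↭-trans (↭.++⁺ʳ φs φs′↭) (↭-swap-tails gφs eφs φs)) (++⁺ E* ⊑*-refl) refl ,
    node ↭-refl ↭-refl (↭⇒↭≈ (↭-swap-tails ds cs ecs))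
  plug-mono-⊑-≈ {⟨ gts ∣ gφs ∣ gcs ⟩} {⟨ gts′ ∣ gφs′ ∣ _ ⟩} (i ∷ p) ts φs cs
                (extend ets eφs ecs ts′↭ φs′↭ E* refl) (there v)
    with modifyL-mono-⊑*-≈ i p ts φs cs E* v
  ... | bs , EB* , bs≈ =
    ⟨ gts′ ∣ gφs′ ∣ bs ++ ecs ⟩ , extend ets eφs ecs ts′↭ φs′↭ EB* refl ,
    node ↭-refl ↭-refl
      (Perm.refl (Eq.subst (Pointwise _≈_ (bs ++ ecs)) (sym (modifyL-++ (add ts φs cs) ecs (ValidL-⊑* E* v)))
                           (++⁺ bs≈ ≈*-refl)))

  modifyL-mono-⊑*-≈ : ∀ {cs′ ds} i p ts φs cs → Pointwise _⊑_ cs′ ds → ValidL i p cs′ →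
                      Σ (List NSeq) λ bs → Pointwise _⊑_ (modifyL i p (add ts φs cs) cs′) bs
                                         × Pointwise _≈_ bs (modifyL i p (add ts φs cs) ds)
  modifyL-mono-⊑*-≈ zero p ts φs cs (E ∷ E*) (vz v) with plug-mono-⊑-≈ p ts φs cs E v
  ... | b , EB , b≈ = b ∷ _ , EB ∷ E* , b≈ ∷ ≈*-refl
  modifyL-mono-⊑*-≈ (suc i) p ts φs cs (E ∷ E*) (vs v) with modifyL-mono-⊑*-≈ i p ts φs cs E* v
  ... | bs , EB* , bs≈ = _ ∷ bs , E ∷ EB* , ≈-refl ∷ bs≈

mutual
  ⊑-plug-inv : ∀ {G B} p ts φs → Valid p G → plug G p ts φs [] ⊑ B →
               Σ NSeq λ G′ → G ⊑ G′ × B ≈ plug G′ p ts φs []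
  ⊑-plug-inv {⟨ gts ∣ gφs ∣ gcs ⟩} [] ts φs here (extend {ds = ds} ets eφs ecs ts′↭ φs′↭ E* refl) =
    ⟨ gts ++ ets ∣ gφs ++ eφs ∣ ds ++ ecs ⟩ ,
    extend ets eφs ecs ↭-refl ↭-refl (Eq.subst (λ cs → Pointwise _⊑_ cs ds) (List.++-identityʳ gcs) E*) refl ,
    node (↭-trans ts′↭ (↭-swap-tails gts ts ets)) (↭-trans φs′↭ (↭-swap-tails gφs φs eφs))
         (Perm.refl (Eq.subst (Pointwise _≈_ (ds ++ ecs)) (sym (List.++-identityʳ (ds ++ ecs))) ≈*-refl))
  ⊑-plug-inv (i ∷ p) ts φs (there v) (extend {ts′ = bts} {φs′ = bφs} ets eφs ecs ts′↭ φs′↭ E* refl)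
    with modifyL-⊑*-inv i p ts φs v E*
  ... | ds′ , E′* , ds≈ , v′ =
    ⟨ bts ∣ bφs ∣ ds′ ++ ecs ⟩ , extend ets eφs ecs ts′↭ φs′↭ E′* refl ,
    node ↭-refl ↭-refl
      (Perm.refl (Eq.subst (Pointwise _≈_ _) (sym (modifyL-++ (add ts φs []) ecs v′)) (++⁺ ds≈ ≈*-refl)))

  modifyL-⊑*-inv : ∀ {cs ds} i p ts φs → ValidL i p cs → Pointwise _⊑_ (modifyL i p (add ts φs []) cs) ds →
                   Σ (List NSeq) λ ds′ → Pointwise _⊑_ cs ds′
                                       × Pointwise _≈_ ds (modifyL i p (add ts φs []) ds′) × ValidL i p ds′
  modifyL-⊑*-inv zero p ts φs (vz v) (E ∷ E*) with ⊑-plug-inv p ts φs v E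
  ... | c′ , Ec , c≈ = c′ ∷ _ , Ec ∷ E* , c≈ ∷ ≈*-refl , vz (Valid-⊑ Ec v)
  modifyL-⊑*-inv (suc i) p ts φs (vs v) (E ∷ E*) with modifyL-⊑*-inv i p ts φs v E*
  ... | ds′ , E′* , ds≈ , v′ = _ ∷ ds′ , E ∷ E′* , ≈-refl ∷ ds≈ , vs v′

transpose : ℕ → ℕ → ℕ → ℕ
transpose a b x with x ≟ a
... | yes _ = b
... | no _ with x ≟ b
...   | yes _ = a
...   | no _  = x

transpose-left : ∀ a b → transpose a b a ≡ b
transpose-left a b with a ≟ a
... | yes _  = refl
... | no a≢a = ⊥-elim (a≢a refl)

transpose-right : ∀ a b → transpose a b b ≡ a
transpose-right a b with b ≟ a
... | yes b≡a = b≡a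
... | no _ with b ≟ b
...   | yes _  = refl
...   | no b≢b = ⊥-elim (b≢b refl)

transpose-other : ∀ {a b x} → x ≢ a → x ≢ b → transpose a b x ≡ x
transpose-other {a} {b} {x} x≢a x≢b with x ≟ a
... | yes x≡a = ⊥-elim (x≢a x≡a)
... | no _ with x ≟ b
...   | yes x≡b = ⊥-elim (x≢b x≡b)
...   | no _    = refl

transpose-involutive : ∀ a b x → transpose a b (transpose a b x) ≡ x
transpose-involutive a b x with x ≟ a
... | yes refl = transpose-right x b
... | no x≢a with x ≟ b
...   | yes refl = transpose-left a x
...   | no x≢b   = transpose-other x≢a x≢b

transpose-injective : ∀ a b → Injective _≡_ _≡_ (transpose a b)
transpose-injective a b {x} {y} e = begin
  x                                   ≡⟨ sym (transpose-involutive a b x) ⟩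
  transpose a b (transpose a b x)     ≡⟨ cong (transpose a b) e ⟩
  transpose a b (transpose a b y)     ≡⟨ transpose-involutive a b y ⟩
  y                                   ∎
  where open ≡-Reasoning

transpose-fixes-FreeS : ∀ {a b S x} → ¬ FreeS a S → ¬ FreeS b S → FreeS x S → transpose a b x ≡ x
transpose-fixes-FreeS a∉S b∉S x∈S = transpose-other (λ { refl → a∉S x∈S }) (λ { refl → b∉S x∈S })

module _ {𝒞 : CondSet} where
  open Calculus 𝒞

  Prf-rename-eigenvariable : ∀ {G y y′ h} p φs → ¬ FreeS y G → ¬ FreeS y′ G →
    Prf (plug G p [ var y ] φs []) h →
    Prf (plug G p [ var y′ ] (map (Renaming.renF (transpose y y′)) φs) []) h
  Prf-rename-eigenvariable {G} {y} {y′} p φs y∉G y′∉G P =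
    Eq.subst (λ S → Prf S _) renamed (Prf-rename (transpose-injective y y′) P)
    where
      open Renaming (transpose y y′)
      open ≡-Reasoning
      renamed : renS (plug G p [ var y ] φs []) ≡ plug G p [ var y′ ] (map renF φs) []
      renamed = begin
        renS (plug G p [ var y ] φs [])
          ≡⟨ renS-plug p G [ var y ] φs [] ⟩
        plug (renS G) p [ var (transpose y y′ y) ] (map renF φs) []
          ≡⟨ cong₂ (λ H z → plug H p [ var z ] (map renF φs) [])
                   (renS-identity G (transpose-fixes-FreeS y∉G y′∉G)) (transpose-left y y′) ⟩
        plug G p [ var y′ ] (map renF φs) [] ∎

  Prf-rename-∀-eigenvariable : ∀ {G p φ y y′ h} → Valid p G →
    ¬ FreeS y (plugF G p [ all φ ]) → ¬ FreeS y′ (plugF G p [ all φ ]) →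
    Prf (plug G p [ var y ] [ inst φ (var y) ] []) h →
    Prf (plug G p [ var y′ ] [ inst φ (var y′) ] []) h
  Prf-rename-∀-eigenvariable {G} {p} {φ} {y} {y′} v y∉C y′∉C P =
    Eq.subst (λ χ → Prf (plug G p [ var y′ ] [ χ ] []) _) renamed
      (Prf-rename-eigenvariable p [ inst φ (var y) ] (y∉C ∘ FreeS-⊑ G⊑C) (y′∉C ∘ FreeS-⊑ G⊑C) P)
    where
      open Renaming (transpose y y′)
      open ≡-Reasoning
      G⊑C : G ⊑ plugF G p [ all φ ]
      G⊑C = ⊑-plug p [] [ all φ ] [] v
      renamed : renF (inst φ (var y)) ≡ inst φ (var y′)
      renamed = begin
        renF (inst φ (var y))                   ≡⟨ renF-inst φ (var y) ⟩
        inst (renF φ) (var (transpose y y′ y))  ≡⟨ cong₂ (λ ψ z → inst ψ (var z)) φ-fixed (transpose-left y y′) ⟩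
        inst φ (var y′)                         ∎
        where
          φ-fixed = renF-identity φ (λ x∈φ → transpose-fixes-FreeS y∉C y′∉C
                                      (FreeS-plug-hole [] [ all φ ] [] v (inj₂ (inj₁ (here x∈φ)))))

⊑-≈plug-inv : ∀ {S T G} p ts φs → S ≈ plug G p ts φs [] → Valid p G → S ⊑ T →
              Σ NSeq λ G′ → G ⊑ G′ × T ≈ plug G′ p ts φs []
⊑-≈plug-inv p ts φs S≈ v S⊑T with ≈-⊑-commute S≈ S⊑T
... | B , plug⊑B , T≈B with ⊑-plug-inv p ts φs v plug⊑B
...   | G′ , G⊑G′ , B≈ = G′ , G⊑G′ , ≈-trans T≈B B≈

plug₂-mono-⊑ : ∀ {G G′} u ts₁ φs₁ w ts₂ φs₂ → G ⊑ G′ → Valid u G → Valid w G →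
               plug (plug G u ts₁ φs₁ []) w ts₂ φs₂ [] ⊑ plug (plug G′ u ts₁ φs₁ []) w ts₂ φs₂ []
plug₂-mono-⊑ u ts₁ φs₁ w ts₂ φs₂ G⊑G′ vu vw =
  plug-mono-⊑ w ts₂ φs₂ (plug-mono-⊑ u ts₁ φs₁ G⊑G′ vu) (Valid-⊑ (⊑-plug u ts₁ φs₁ [] vu) vw)

module _ {𝒞 : CondSet} where
  open Calculus 𝒞

  -- The bound n is there for termination: the (∀) and (nd) cases recurse on a renamed premise.
  Prf-⊑-bounded : ∀ n {S T h} → h ≤ n → Prf S h → S ⊑ T → Prf T h
  Prf-⊑-bounded n _ (ax {p = p} {L = L} v l e) E with ⊑-≈plug-inv p [] (L ∷ dual L ∷ []) e v E
  ... | G′ , G⊑G′ , e′ = ax (Valid-⊑ G⊑G′ v) l e′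
  Prf-⊑-bounded (suc n) (s≤s h≤n) (or {p = p} {φ = φ} {ψ = ψ} v P e) E
    with ⊑-≈plug-inv p [] [ φ ∨ ψ ] e v E
  ... | G′ , G⊑G′ , e′ =
    or (Valid-⊑ G⊑G′ v) (Prf-⊑-bounded n h≤n P (plug-mono-⊑ p [] (φ ∷ ψ ∷ []) G⊑G′ v)) e′
  Prf-⊑-bounded (suc n) (s≤s h≤n) (and {p = p} {φ = φ} {ψ = ψ} {h₁ = h₁} {h₂ = h₂} v P Q e) E
    with ⊑-≈plug-inv p [] [ φ ∧ ψ ] e v E
  ... | G′ , G⊑G′ , e′ =
    and (Valid-⊑ G⊑G′ v)
        (Prf-⊑-bounded n (≤-trans (m≤m⊔n h₁ h₂) h≤n) P (plug-mono-⊑ p [] [ φ ] G⊑G′ v))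
        (Prf-⊑-bounded n (≤-trans (m≤n⊔m h₁ h₂) h≤n) Q (plug-mono-⊑ p [] [ ψ ] G⊑G′ v)) e′
  Prf-⊑-bounded (suc n) (s≤s h≤n) (exR {p = p} {t = t} {ψ = ψ} v P e) E
    with ⊑-≈plug-inv p [ t ] [ ex ψ ] e v E
  ... | G′ , G⊑G′ , e′ =
    exR (Valid-⊑ G⊑G′ v) (Prf-⊑-bounded n h≤n P (plug-mono-⊑ p [ t ] (ex ψ ∷ inst ψ t ∷ []) G⊑G′ v)) e′
  Prf-⊑-bounded (suc n) (s≤s h≤n) (allR {G = G} {p = p} {φ = φ} {y = y} v y∉C P e) E
    with ⊑-≈plug-inv p [] [ all φ ] e v E
  ... | G′ , G⊑G′ , e′ =
    allR (Valid-⊑ G⊑G′ v) (varBound-fresh C′)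
         (Prf-⊑-bounded n h≤n (Prf-rename-∀-eigenvariable v y∉C y′∉C P)
                        (plug-mono-⊑ p [ var y′ ] [ inst φ (var y′) ] G⊑G′ v)) e′
    where
      C′ = plugF G′ p [ all φ ]
      y′ = varBound C′
      y′∉C : ¬ FreeS y′ (plugF G p [ all φ ])
      y′∉C = varBound-fresh C′ ∘ FreeS-⊑ (plug-mono-⊑ p [] [ all φ ] G⊑G′ v)
  Prf-⊑-bounded (suc n) (s≤s h≤n) (diaR {w = w} {u = u} {φ = φ} v vu r P e) E
    with ⊑-≈plug-inv w [] [ dia φ ] e v E
  ... | G′ , G⊑G′ , e′ =
    diaR (Valid-⊑ G⊑G′ v) (Valid-⊑ G⊑G′ vu) (Reach-mono (Valid-⊑ G⊑G′) r)
         (Prf-⊑-bounded n h≤n P (plug₂-mono-⊑ u [] [ φ ] w [] [ dia φ ] G⊑G′ vu v)) e′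
  Prf-⊑-bounded (suc n) (s≤s h≤n) (boxR {p = p} {φ = φ} v P e) E
    with ⊑-≈plug-inv p [] [ box φ ] e v E
  ... | G′ , G⊑G′ , e′ with plug-mono-⊑-≈ p [] [] [ ⟨ [] ∣ [ φ ] ∣ [] ⟩ ] G⊑G′ v
  ...   | B , E′ , B≈ = boxR (Valid-⊑ G⊑G′ v) (Prf-resp-≈ B≈ (Prf-⊑-bounded n h≤n P E′)) e′
  Prf-⊑-bounded (suc n) (s≤s h≤n) (ref {p = p} {t = t} v P e) E with ≈-⊑-commute e E
  ... | G′ , G⊑G′ , e′ =
    ref (Valid-⊑ G⊑G′ v) (Prf-⊑-bounded n h≤n P (plug-mono-⊑ p [] [ neq (fr t) (fr t) ] G⊑G′ v)) e′
  Prf-⊑-bounded (suc n) (s≤s h≤n) (rep {p = p} {t = t} {s = s} {N = N} {z = z} v nl P e) E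
    with ⊑-≈plug-inv p [] (neq (fr t) (fr s) ∷ subst N t z ∷ []) e v E
  ... | G′ , G⊑G′ , e′ =
    rep (Valid-⊑ G⊑G′ v) nl
        (Prf-⊑-bounded n h≤n P
          (plug-mono-⊑ p [] (neq (fr t) (fr s) ∷ subst N t z ∷ subst N s z ∷ []) G⊑G′ v)) e′
  Prf-⊑-bounded (suc n) (s≤s h≤n) (drep {p = p} {t = t} {s = s} v P e) E
    with ⊑-≈plug-inv p [ t ] [ neq (fr t) (fr s) ] e v E
  ... | G′ , G⊑G′ , e′ =
    drep (Valid-⊑ G⊑G′ v)
         (Prf-⊑-bounded n h≤n P (plug-mono-⊑ p (s ∷ t ∷ []) [ neq (fr t) (fr s) ] G⊑G′ v)) e′
  Prf-⊑-bounded (suc n) (s≤s h≤n) (rig {w = w} {u = u} {s = s} {t = t} v vu w≢u P e) E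
    with ⊑-≈plug-inv w [] [ neq (fr s) (fr t) ] e v E
  ... | G′ , G⊑G′ , e′ =
    rig (Valid-⊑ G⊑G′ v) (Valid-⊑ G⊑G′ vu) w≢u
        (Prf-⊑-bounded n h≤n P (plug₂-mono-⊑ u [] [ neq (fr s) (fr t) ] w [] [ neq (fr s) (fr t) ] G⊑G′ vu v)) e′
  Prf-⊑-bounded (suc n) (s≤s h≤n) (dpID {w = w} {u = u} {t = t} a b v vu w≢u r P e) E
    with ⊑-≈plug-inv w [ t ] [] e v E
  ... | G′ , G⊑G′ , e′ =
    dpID a b (Valid-⊑ G⊑G′ v) (Valid-⊑ G⊑G′ vu) w≢u (Reach-mono (Valid-⊑ G⊑G′) r)
         (Prf-⊑-bounded n h≤n P (plug₂-mono-⊑ u [ t ] [] w [ t ] [] G⊑G′ vu v)) e′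
  Prf-⊑-bounded (suc n) (s≤s h≤n) (dpDD {w = w} {u = u} {t = t} a b v vu w≢u r P e) E
    with ⊑-≈plug-inv w [ t ] [] e v E
  ... | G′ , G⊑G′ , e′ =
    dpDD a b (Valid-⊑ G⊑G′ v) (Valid-⊑ G⊑G′ vu) w≢u (Reach-mono (Valid-⊑ G⊑G′) r)
         (Prf-⊑-bounded n h≤n P (plug₂-mono-⊑ u [ t ] [] w [ t ] [] G⊑G′ vu v)) e′
  Prf-⊑-bounded (suc n) (s≤s h≤n) (dpIDDD {w = w} {u = u} {t = t} a b v vu w≢u r P e) E
    with ⊑-≈plug-inv w [ t ] [] e v E
  ... | G′ , G⊑G′ , e′ =
    dpIDDD a b (Valid-⊑ G⊑G′ v) (Valid-⊑ G⊑G′ vu) w≢u (Reach-mono (Valid-⊑ G⊑G′) r)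
           (Prf-⊑-bounded n h≤n P (plug₂-mono-⊑ u [ t ] [] w [ t ] [] G⊑G′ vu v)) e′
  Prf-⊑-bounded (suc n) (s≤s h≤n) (d {p = p} c v P e) E with ≈-⊑-commute e E
  ... | G′ , G⊑G′ , e′ with plug-mono-⊑-≈ p [] [] [ emptyS ] G⊑G′ v
  ...   | B , E′ , B≈ = d c (Valid-⊑ G⊑G′ v) (Prf-resp-≈ B≈ (Prf-⊑-bounded n h≤n P E′)) e′
  Prf-⊑-bounded (suc n) (s≤s h≤n) (nd {p = p} {y = y} c v y∉G P e) E with ≈-⊑-commute e E
  ... | G′ , G⊑G′ , e′ =
    nd c (Valid-⊑ G⊑G′ v) (varBound-fresh G′)
       (Prf-⊑-bounded n h≤n (Prf-rename-eigenvariable p [] y∉G (varBound-fresh G′ ∘ FreeS-⊑ G⊑G′) P)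
                      (plug-mono-⊑ p [ var (varBound G′) ] [] G⊑G′ v)) e′
  Prf-⊑-bounded (suc n) (s≤s h≤n) (cd {p = p} {t = t} c v P e) E with ≈-⊑-commute e E
  ... | G′ , G⊑G′ , e′ = cd c (Valid-⊑ G⊑G′ v) (Prf-⊑-bounded n h≤n P (plug-mono-⊑ p [ t ] [] G⊑G′ v)) e′

  Prf-⊑ : ∀ {S T h} → Prf S h → S ⊑ T → Prf T h
  Prf-⊑ {h = h} = Prf-⊑-bounded h ≤-refl

  HPAdm-⊑ : ∀ {S T} → S ⊑ T → HPAdm S T
  HPAdm-⊑ S⊑T h P = h , ≤-refl , Prf-⊑ P S⊑T

  HPAdm-nest : ∀ {S} → HPAdm S (nest S)
  HPAdm-nest h P = h , ≤-refl , Prf-nest P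

mainTheorem7 : (𝒞 : CondSet) → Closed 𝒞 →
    let open Calculus 𝒞 in
    (∀ (G : NSeq) p (φ : Formula) → Valid p G → HPAdm G (plugF G p [ φ ]))
    × (∀ (G : NSeq) p (t : Term) → Valid p G → HPAdm G (plug G p [ t ] [] []))
    × (∀ (G : NSeq) p → Valid p G → HPAdm G (plug G p [] [] [ emptyS ]))
    × (∀ (G : NSeq) → HPAdm G ⟨ [] ∣ [] ∣ [ G ] ⟩)
mainTheorem7 𝒞 _ =
  (λ G p φ v → HPAdm-⊑ (⊑-plug p [] [ φ ] [] v)) ,
  (λ G p t v → HPAdm-⊑ (⊑-plug p [ t ] [] [] v)) ,
  (λ G p v → HPAdm-⊑ (⊑-plug p [] [] [ emptyS ] v)) ,
  (λ G → HPAdm-nest)
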